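{- Let $f,g\in\mathcal O_K$. 1. If $f,g\in\mathcal O_K^0$, then $|f|_\theta|g|_\theta\le|fg|_\theta\le\theta|f|_\theta|g|_\theta$. 2. If $f,g\in\mathcal O_K^1$, then $|f|_\theta|g|_\theta\le|fg|_\theta\le\theta^2|f|_\theta|g|_\theta$. 3. If $f\in\mathcal O_K^0$ and $g\in\mathcal O_K^1$, then $|f|_\theta|g|_\theta\le|fg|_\theta\le\theta|f|_\theta|g|_\theta$.
   Context: $\theta>1$ is a real quadratic unit with $N(\theta)=1$, so $\theta^2=a\theta-1$ with an integer $a\ge3$ and the conjugate is $\theta'=\theta^{ -1}$; $K=\mathbb Q(\theta)\subset\mathbb R$, $\mathcal O_K$ its ring of integers, $\alpha'$ the Galois conjugate of $\alpha$. A greedy polynomial is a finite sum $\sum_{i=m}^M b_i\theta^i$ with $b_i\in\{0,\dots,a-1\}$ containing no digit subword $b_ib_{i-1}\cdots b_{i-k}$ ($k\ge1$) of the form $(a-1)(a-2)\cdots(a-2)(a-1)$ (including $(a-1)(a-1)$). Let $\mathcal O_K^0=\{\alpha\in\mathcal O_K:\operatorname{sgn}\alpha=\operatorname{sgn}\alpha'\}\cup\{0\}$ and $\mathcal O_K^1=\{\alpha\in\mathcal O_K:\operatorname{sgn}\alpha\ne\operatorname{sgn}\alpha'\}\cup\{0\}$. Each nonzero $\alpha\in\mathcal O_K^0$ can be written uniquely as $\alpha=\pm\sum_{i=m}^Mb_i\theta^i$, a greedy polynomial with $b_m\neq0$; set $|\alpha|_\theta=\theta^{ -m}$ and $|0|_\theta=0$.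 Let $T=\theta-1$; for $\alpha\in\mathcal O_K^1$ one has $T\alpha\in\mathcal O_K^0$ and one defines $|\alpha|_\theta:=|T\alpha|_\theta$. -}

module Defs where

open import Data.Nat as ℕ using (ℕ; zero; suc)
open import Data.Integer as ℤ using (ℤ; +_; -[1+_])
open import Data.List using (List; []; _∷_; _++_; [_]; replicate)
open import Data.Product using (Σ; ∃; _×_; _,_)
open import Data.Sum using (_⊎_)
open import Relation.Binary.PropositionalEquality using (_≡_; _≢_)

-- Elements x + y·θ of ℤ[θ], where θ is the larger root of t² - a t + 1
-- (a ≥ 3 is passed explicitly to every operation that needs it).
record Zθ : Set where
  constructor ⟨_,_⟩
  field
    x : ℤ
    y : ℤ
open Zθ public

zero' : Zθ
zero' = ⟨ + 0 , + 0 ⟩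

one' : Zθ
one' = ⟨ + 1 , + 0 ⟩

θ' : Zθ
θ' = ⟨ + 0 , + 1 ⟩

T' : Zθ
T' = ⟨ ℤ.- (+ 1) , + 1 ⟩

fromℕ' : ℕ → Zθ
fromℕ' n = ⟨ + n , + 0 ⟩

add : Zθ → Zθ → Zθ
add ⟨ x₁ , y₁ ⟩ ⟨ x₂ , y₂ ⟩ = ⟨ x₁ ℤ.+ x₂ , y₁ ℤ.+ y₂ ⟩

neg : Zθ → Zθ
neg ⟨ x₁ , y₁ ⟩ = ⟨ ℤ.- x₁ , ℤ.- y₁ ⟩

sub : Zθ → Zθ → Zθ
sub α β = add α (neg β)

-- (x₁ + y₁θ)(x₂ + y₂θ) using θ² = aθ - 1
mul : ℕ → Zθ → Zθ → Zθ
mul a ⟨ x₁ , y₁ ⟩ ⟨ x₂ , y₂ ⟩ =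
  ⟨ x₁ ℤ.* x₂ ℤ.- y₁ ℤ.* y₂ , x₁ ℤ.* y₂ ℤ.+ x₂ ℤ.* y₁ ℤ.+ (+ a) ℤ.* (y₁ ℤ.* y₂) ⟩

-- Galois conjugate: θ ↦ θ⁻¹ = a - θ
conj : ℕ → Zθ → Zθ
conj a ⟨ x₁ , y₁ ⟩ = ⟨ x₁ ℤ.+ (+ a) ℤ.* y₁ , ℤ.- y₁ ⟩

θinv : ℕ → Zθ
θinv a = ⟨ + a , ℤ.- (+ 1) ⟩

powℕ : ℕ → Zθ → ℕ → Zθ
powℕ a β zero    = one'
powℕ a β (suc n) = mul a β (powℕ a β n)

θ^ : ℕ → ℤ → Zθ
θ^ a (+ n)     = powℕ a θ' n
θ^ a -[1+ n ]  = powℕ a (θinv a) (suc n)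

-- Positivity of the real number x + yθ (embedding with θ > 1):
-- 2(x + yθ) = u + y√D with u = 2x + a y, D = a² - 4.
Pos : ℕ → Zθ → Set
Pos a ⟨ x₁ , y₁ ⟩ =
    (ℤ.0ℤ ℤ.< u × ℤ.0ℤ ℤ.≤ y₁)
  ⊎ (ℤ.0ℤ ℤ.≤ u × ℤ.0ℤ ℤ.< y₁)
  ⊎ (ℤ.0ℤ ℤ.< u × y₁ ℤ.< ℤ.0ℤ × y₁ ℤ.* y₁ ℤ.* D ℤ.< u ℤ.* u)
  ⊎ (u ℤ.< ℤ.0ℤ × ℤ.0ℤ ℤ.< y₁ × u ℤ.* u ℤ.< y₁ ℤ.* y₁ ℤ.* D)
  where
    u = (+ 2) ℤ.* x₁ ℤ.+ (+ a) ℤ.* y₁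
    D = (+ a) ℤ.* (+ a) ℤ.- (+ 4)

Neg : ℕ → Zθ → Set
Neg a α = Pos a (neg α)

_≤[_]_ : Zθ → ℕ → Zθ → Set
α ≤[ a ] β = (sub β α ≡ zero') ⊎ Pos a (sub β α)

O0 : ℕ → Zθ → Set
O0 a α = (Pos a α × Pos a (conj a α)) ⊎ (Neg a α × Neg a (conj a α)) ⊎ (α ≡ zero')

O1 : ℕ → Zθ → Set
O1 a α = (Pos a α × Neg a (conj a α)) ⊎ (Neg a α × Pos a (conj a α)) ⊎ (α ≡ zero')

-- Digit lists are read from the lowest exponent upward: b_m, b_{m+1}, ..., b_M.
-- Value Σ_j b_{m+j} θ^j  (Horner)
evalDigits : ℕ → List ℕ → Zθ
evalDigits a []       = zero'
evalDigits a (b ∷ bs) = add (fromℕ' b) (mul a θ' (evalDigits a bs))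

AllDigits : ℕ → List ℕ → Set
AllDigits a []       = Data.Unit.⊤ where import Data.Unit
AllDigits a (b ∷ bs) = (b ℕ.< a) × AllDigits a bs

-- forbidden word (a-1)(a-2)…(a-2)(a-1) with k ≥ 1 (includes (a-1)(a-1));
-- it is a palindrome, so the reading direction is irrelevant
ForbiddenWord : ℕ → ℕ → List ℕ
ForbiddenWord a n = ((a ℕ.∸ 1) ∷ replicate n (a ℕ.∸ 2)) ++ [ a ℕ.∸ 1 ]

HasForbidden : ℕ → List ℕ → Set
HasForbidden a ds =
  Σ ℕ λ n → Σ (List ℕ) λ pre → Σ (List ℕ) λ suf → ds ≡ pre ++ ForbiddenWord a n ++ suf

GreedyNZ : ℕ → List ℕ → Set
GreedyNZ a []       = Data.Empty.⊥ where import Data.Empty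
GreedyNZ a (b ∷ bs) = (b ≢ 0) × AllDigits a (b ∷ bs) × ((HasForbidden a (b ∷ bs)) → Data.Empty.⊥)
  where import Data.Empty

-- |α|_θ = v for α ∈ 𝒪_K^0 :  α = ± Σ_{i=m}^M b_i θ^i greedy with b_m ≠ 0, v = θ^{-m};  |0|_θ = 0
AbsIs0 : ℕ → Zθ → Zθ → Set
AbsIs0 a α v =
    (α ≡ zero' × v ≡ zero')
  ⊎ (α ≢ zero' × Σ ℤ λ m → Σ (List ℕ) λ ds → GreedyNZ a ds
        × ((α ≡ mul a (θ^ a m) (evalDigits a ds)) ⊎ (α ≡ neg (mul a (θ^ a m) (evalDigits a ds))))
        × v ≡ θ^ a (ℤ.- m))

-- |α|_θ = v for α ∈ 𝒪_K = 𝒪_K^0 ∪ 𝒪_K^1 ; on 𝒪_K^1, |α|_θ := |Tα|_θ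
AbsIs : ℕ → Zθ → Zθ → Set
AbsIs a α v = (O0 a α × AbsIs0 a α v) ⊎ (O1 a α × AbsIs0 a (mul a T' α) v)

{-# OPTIONS --safe #-}
module Submission where

-- Writing θ = (a + √D) / 2 with D = a² - 4, an element α = x + y θ satisfies 2 α = U + y √D with
-- U = 2 x + a y, so the real order of ℤ[θ] is decided by integer inequalities; the cone
-- u + y √D > 0 of ℤ[√D] is closed under sums and products, which makes ℤ[θ] an ordered ring.
-- If α = ± θ^m (b₀ + b₁ θ + ...) is the greedy expansion of α ∈ 𝒪_K^0, b₀ ≠ 0, then
-- α' = ± θ^(-m) e with e = b₀ + b₁ θ⁻¹ + ..., and the greedy condition gives 1 ≤ e < θ: thus
-- |α|_θ = θ^(-m) is the largest power of θ not exceeding |α'|. Conjugating a relation α β = c γ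
-- and comparing powers of θ gives |α|_θ |β|_θ ≤ |γ|_θ ≤ θ^(1+j) |α|_θ |β|_θ whenever
-- θ^(-j) ≤ c' ≤ 1. The three parts take (α, β, γ, c) = (f, g, f g, 1), (T f, T g, f g, (a-2) θ),
-- using T² = (a - 2) θ, and (f, T g, T (f g), 1); which of these lie in 𝒪_K^0 follows from the
-- multiplicativity of sgn α · sgn α'.

open import Defs
open import Algebra.Bundles using (CommutativeRing)
open import Algebra.Structures using (IsCommutativeRing)
import Algebra.Properties.CommutativeSemigroup as CommutativeSemigroupProperties
import Algebra.Properties.Ring as RingProperties
open import Data.Integer.Base as ℤ using (ℤ; +_; -[1+_]; +[1+_]; +0; 0ℤ)
import Data.Integer.Properties as ℤ
open import Data.Integer.Solver using (module +-*-Solver)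
open import Data.Integer.Tactic.RingSolver using (solve-∀)
open import Data.List.Base using (List; []; _∷_; _++_)
open import Data.List.Properties using (∷-injectiveʳ)
open import Data.Nat.Base as ℕ using (ℕ; zero; suc)
import Data.Nat.Properties as ℕ
open import Data.Product.Base using (_×_; _,_; Σ; proj₁; proj₂)
open import Data.Sign.Base as Sign using (Sign)
import Data.Sign.Properties as Sign
open import Data.Sum.Base using (_⊎_; inj₁; inj₂; [_,_])
open import Function.Base using (_∘_)
open import Level using (0ℓ)
open import Relation.Binary.PropositionalEquality hiding ([_])
open import Relation.Binary.Structures using (IsPreorder)
import Relation.Binary.Reasoning.Base.Triple as Triple
open import Relation.Nullary.Decidable.Core using (yes; no)
open import Relation.Nullary.Negation using (¬_; contradiction)

module IntegerInequalities where

  open import Data.Integer.Base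
  open import Data.Integer.Properties
  open import Data.Integer.Tactic.RingSolver using (solve)

  <-from-gap : ∀ {i j} d → j ≡ i + d → 0ℤ < d → i < j
  <-from-gap {i} d refl 0<d = subst (_< i + d) (+-identityʳ i) (+-monoʳ-< i 0<d)

  ≤-from-gap : ∀ {i j} d → j ≡ i + d → 0ℤ ≤ d → i ≤ j
  ≤-from-gap {i} d refl 0≤d = subst (_≤ i + d) (+-identityʳ i) (+-monoʳ-≤ i 0≤d)

  i<j⇒0<j-i : ∀ {i j} → i < j → 0ℤ < j - i
  i<j⇒0<j-i {i} {j} i<j = subst (_< j - i) (+-inverseʳ i) (+-monoˡ-< (- i) i<j)

  *-pos : ∀ {i j} → 0ℤ < i → 0ℤ < j → 0ℤ < i * j
  *-pos {i} {j} 0<i 0<j = subst (_< i * j) (*-zeroʳ i) (*-monoˡ-<-pos i {{positive 0<i}} 0<j)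

  *-nonNeg : ∀ {i j} → 0ℤ ≤ i → 0ℤ ≤ j → 0ℤ ≤ i * j
  *-nonNeg {i} {j} 0≤i 0≤j = subst (_≤ i * j) (*-zeroʳ i) (*-monoˡ-≤-nonNeg i {{nonNegative 0≤i}} 0≤j)

  neg*neg : ∀ {i j} → i < 0ℤ → j < 0ℤ → 0ℤ < i * j
  neg*neg {i} {j} i<0 j<0 = begin-strict
    0ℤ        <⟨ *-pos (neg-mono-< i<0) (neg-mono-< j<0) ⟩
    - i * - j ≡⟨ solve (i ∷ j ∷ []) ⟩
    i * j     ∎
    where open ≤-Reasoning

  pos*neg : ∀ {i j} → 0ℤ < i → j < 0ℤ → i * j < 0ℤ
  pos*neg {i} {j} 0<i j<0 = begin-strict
    i * j         ≡⟨ solve (i ∷ j ∷ []) ⟩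
    - (i * - j)   <⟨ neg-mono-< (*-pos 0<i (neg-mono-< j<0)) ⟩
    0ℤ            ∎
    where open ≤-Reasoning

  neg*pos : ∀ {i j} → i < 0ℤ → 0ℤ < j → i * j < 0ℤ
  neg*pos {i} {j} i<0 0<j = subst (_< 0ℤ) (*-comm j i) (pos*neg 0<j i<0)

  0<i*c⇒0<i : ∀ {i c} → 0ℤ < c → 0ℤ < i * c → 0ℤ < i
  0<i*c⇒0<i {i} {c} 0<c 0<ic = *-cancelʳ-<-nonNeg c {{nonNegative (<⇒≤ 0<c)}}
    (subst (_< i * c) (sym (*-zeroˡ c)) 0<ic)

  0<c*i⇒0<i : ∀ {c i} → 0ℤ < c → 0ℤ < c * i → 0ℤ < i
  0<c*i⇒0<i {c} {i} 0<c 0<ci = *-cancelˡ-<-nonNeg c {{nonNegative (<⇒≤ 0<c)}}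
    (subst (_< c * i) (sym (*-zeroʳ c)) 0<ci)

  0≤c*i⇒0≤i : ∀ {c i} → 0ℤ < c → 0ℤ ≤ c * i → 0ℤ ≤ i
  0≤c*i⇒0≤i {c} {i} 0<c 0≤ci = *-cancelˡ-≤-pos 0ℤ i c {{positive 0<c}}
    (subst (_≤ c * i) (sym (*-zeroʳ c)) 0≤ci)

  c*i<0⇒i<0 : ∀ {c i} → 0ℤ < c → c * i < 0ℤ → i < 0ℤ
  c*i<0⇒i<0 {c} {i} 0<c ci<0 = *-cancelˡ-<-nonNeg c {{nonNegative (<⇒≤ 0<c)}}
    (subst (c * i <_) (sym (*-zeroʳ c)) ci<0)

  square-nonNeg : ∀ i → 0ℤ ≤ i * i
  square-nonNeg i with 0ℤ ≤? i
  ... | yes 0≤i = *-nonNeg 0≤i 0≤i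
  ... | no  0≰i = <⇒≤ (neg*neg (≰⇒> 0≰i) (≰⇒> 0≰i))

  square-mono-≤ : ∀ {i j} → 0ℤ ≤ i → i ≤ j → i * i ≤ j * j
  square-mono-≤ {i} {j} 0≤i i≤j = ≤-from-gap ((j - i) * (j + i)) (solve (i ∷ j ∷ []))
    (*-nonNeg (i≤j⇒0≤j-i i≤j) (+-mono-≤ (≤-trans 0≤i i≤j) 0≤i))

  square-mono-< : ∀ {i j} → 0ℤ ≤ i → i < j → i * i < j * j
  square-mono-< {i} {j} 0≤i i<j = <-from-gap ((j - i) * (j + i)) (solve (i ∷ j ∷ []))
    (*-pos (i<j⇒0<j-i i<j) (+-mono-<-≤ (≤-<-trans 0≤i i<j) 0≤i))

  square-antimono-≤ : ∀ {i j} → j ≤ 0ℤ → i ≤ j → j * j ≤ i * i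
  square-antimono-≤ {i} {j} j≤0 i≤j = begin
    j * j     ≡⟨ solve (j ∷ []) ⟩
    - j * - j ≤⟨ square-mono-≤ (neg-mono-≤ j≤0) (neg-mono-≤ i≤j) ⟩
    - i * - i ≡⟨ solve (i ∷ []) ⟩
    i * i     ∎
    where open ≤-Reasoning

  square-cancel-< : ∀ {i j} → 0ℤ ≤ j → i * i < j * j → i < j
  square-cancel-< {i} {j} 0≤j i²<j² with i <? j
  ... | yes i<j = i<j
  ... | no  i≮j = contradiction (≤-<-trans (square-mono-≤ 0≤j (≮⇒≥ i≮j)) i²<j²) (<-irrefl refl)

  *-mono-<-nonNeg : ∀ {i j k l} → 0ℤ ≤ i → i < j → 0ℤ ≤ k → k < l → i * k < j * l
  *-mono-<-nonNeg {i} {j} {k} {l} 0≤i i<j 0≤k k<l =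
    <-from-gap ((j - i) * l + i * (l - k)) (solve (i ∷ j ∷ k ∷ l ∷ []))
      (+-mono-<-≤ (*-pos (i<j⇒0<j-i i<j) (≤-<-trans 0≤k k<l)) (*-nonNeg 0≤i (<⇒≤ (i<j⇒0<j-i k<l))))

  geometric-mean-< : ∀ {p₁ q₁ p₂ q₂ r s} → 0ℤ ≤ p₁ → p₁ < q₁ → 0ℤ ≤ p₂ → p₂ < q₂ →
                     r * r ≡ p₁ * p₂ → s * s ≡ q₁ * q₂ → 0ℤ ≤ s → r < s
  geometric-mean-< {p₁} {q₁} {p₂} {q₂} {r} {s} 0≤p₁ p₁<q₁ 0≤p₂ p₂<q₂ r² s² 0≤s =
    square-cancel-< 0≤s (begin-strict
      r * r    ≡⟨ r² ⟩
      p₁ * p₂  <⟨ *-mono-<-nonNeg 0≤p₁ p₁<q₁ 0≤p₂ p₂<q₂ ⟩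
      q₁ * q₂  ≡⟨ s² ⟨
      s * s    ∎)
    where open ≤-Reasoning

  *-cancelʳ-<-square : ∀ {i j} c → i * (c * c) < j * (c * c) → i < j
  *-cancelʳ-<-square c = *-cancelʳ-<-nonNeg (c * c) {{nonNegative (square-nonNeg c)}}

module SqrtCone (D : ℤ) (0<D : 0ℤ ℤ.< D) where

  open import Data.Integer.Base
  open import Data.Integer.Properties
  open import Data.Integer.Tactic.RingSolver using (solve)
  open import Relation.Binary.Definitions using (tri<; tri≈; tri>)
  open IntegerInequalities

  -- Pos√ u y says u + y √D > 0: by the signs of u and y, comparing u² with y² D when they differ.
  data Pos√ (u y : ℤ) : Set where
    u>0         : 0ℤ < u → 0ℤ ≤ y → Pos√ u y
    y>0         : 0ℤ ≤ u → 0ℤ < y → Pos√ u y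
    u-dominates : 0ℤ < u → y < 0ℤ → y * y * D < u * u → Pos√ u y
    y-dominates : u < 0ℤ → 0ℤ < y → u * u < y * y * D → Pos√ u y

  ¬Pos√0 : ¬ Pos√ 0ℤ 0ℤ
  ¬Pos√0 (u>0 0<0 _)             = <-irrefl refl 0<0
  ¬Pos√0 (y>0 _ 0<0)             = <-irrefl refl 0<0
  ¬Pos√0 (u-dominates 0<0 _ _)   = <-irrefl refl 0<0
  ¬Pos√0 (y-dominates 0<0 _ _)   = <-irrefl refl 0<0

  Pos√-upward : ∀ {u y p q} → Pos√ u y → 0ℤ ≤ p → 0ℤ ≤ q → Pos√ (u + p) (y + q)
  Pos√-upward (u>0 0<u 0≤y) 0≤p 0≤q = u>0 (+-mono-<-≤ 0<u 0≤p) (+-mono-≤ 0≤y 0≤q)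
  Pos√-upward (y>0 0≤u 0<y) 0≤p 0≤q = y>0 (+-mono-≤ 0≤u 0≤p) (+-mono-<-≤ 0<y 0≤q)
  Pos√-upward {u} {y} {p} {q} (u-dominates 0<u y<0 y²D<u²) 0≤p 0≤q with 0ℤ ≤? y + q
  ... | yes 0≤y+q = u>0 (+-mono-<-≤ 0<u 0≤p) 0≤y+q
  ... | no  0≰y+q = u-dominates (+-mono-<-≤ 0<u 0≤p) (≰⇒> 0≰y+q) (begin-strict
    (y + q) * (y + q) * D  ≤⟨ *-monoʳ-≤-nonNeg D {{nonNegative (<⇒≤ 0<D)}}
                                (square-antimono-≤ (<⇒≤ (≰⇒> 0≰y+q)) (i≤i+j y q {{nonNegative 0≤q}})) ⟩
    y * y * D              <⟨ y²D<u² ⟩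
    u * u                  ≤⟨ square-mono-≤ (<⇒≤ 0<u) (i≤i+j u p {{nonNegative 0≤p}}) ⟩
    (u + p) * (u + p)      ∎)
    where open ≤-Reasoning
  Pos√-upward {u} {y} {p} {q} (y-dominates u<0 0<y u²<y²D) 0≤p 0≤q with 0ℤ ≤? u + p
  ... | yes 0≤u+p = y>0 0≤u+p (+-mono-<-≤ 0<y 0≤q)
  ... | no  0≰u+p = y-dominates (≰⇒> 0≰u+p) (+-mono-<-≤ 0<y 0≤q) (begin-strict
    (u + p) * (u + p)      ≤⟨ square-antimono-≤ (<⇒≤ (≰⇒> 0≰u+p)) (i≤i+j u p {{nonNegative 0≤p}}) ⟩
    u * u                  <⟨ u²<y²D ⟩
    y * y * D              ≤⟨ *-monoʳ-≤-nonNeg D {{nonNegative (<⇒≤ 0<D)}}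
                                (square-mono-≤ (<⇒≤ 0<y) (i≤i+j y q {{nonNegative 0≤q}})) ⟩
    (y + q) * (y + q) * D  ∎)
    where open ≤-Reasoning

  private
    0≤²D : ∀ y → 0ℤ ≤ y * y * D
    0≤²D y = *-nonNeg (square-nonNeg y) (<⇒≤ 0<D)

    u-dominates-+ : ∀ {u₁ y₁ u₂ y₂} → 0ℤ < u₁ → y₁ < 0ℤ → y₁ * y₁ * D < u₁ * u₁ →
                    0ℤ < u₂ → y₂ < 0ℤ → y₂ * y₂ * D < u₂ * u₂ → Pos√ (u₁ + u₂) (y₁ + y₂)
    u-dominates-+ {u₁} {y₁} {u₂} {y₂} 0<u₁ y₁<0 h₁ 0<u₂ y₂<0 h₂ =
      u-dominates (+-mono-< 0<u₁ 0<u₂) (+-mono-< y₁<0 y₂<0)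
        (<-from-gap ((u₁ * u₁ - y₁ * y₁ * D) + (u₂ * u₂ - y₂ * y₂ * D)
                     + ((u₁ * u₂ - y₁ * y₂ * D) + (u₁ * u₂ - y₁ * y₂ * D)))
          (solve (u₁ ∷ y₁ ∷ u₂ ∷ y₂ ∷ D ∷ []))
          (+-mono-< (+-mono-< (i<j⇒0<j-i h₁) (i<j⇒0<j-i h₂)) (+-mono-< (i<j⇒0<j-i cross) (i<j⇒0<j-i cross))))
      where
      cross : y₁ * y₂ * D < u₁ * u₂
      cross = geometric-mean-< (0≤²D y₁) h₁ (0≤²D y₂) h₂
        (solve (y₁ ∷ y₂ ∷ D ∷ [])) (solve (u₁ ∷ u₂ ∷ [])) (<⇒≤ (*-pos 0<u₁ 0<u₂))

    y-dominates-+ : ∀ {u₁ y₁ u₂ y₂} → u₁ < 0ℤ → 0ℤ < y₁ → u₁ * u₁ < y₁ * y₁ * D →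
                    u₂ < 0ℤ → 0ℤ < y₂ → u₂ * u₂ < y₂ * y₂ * D → Pos√ (u₁ + u₂) (y₁ + y₂)
    y-dominates-+ {u₁} {y₁} {u₂} {y₂} u₁<0 0<y₁ h₁ u₂<0 0<y₂ h₂ =
      y-dominates (+-mono-< u₁<0 u₂<0) (+-mono-< 0<y₁ 0<y₂)
        (<-from-gap ((y₁ * y₁ * D - u₁ * u₁) + (y₂ * y₂ * D - u₂ * u₂)
                     + ((y₁ * y₂ * D - u₁ * u₂) + (y₁ * y₂ * D - u₁ * u₂)))
          (solve (u₁ ∷ y₁ ∷ u₂ ∷ y₂ ∷ D ∷ []))
          (+-mono-< (+-mono-< (i<j⇒0<j-i h₁) (i<j⇒0<j-i h₂)) (+-mono-< (i<j⇒0<j-i cross) (i<j⇒0<j-i cross))))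
      where
      cross : u₁ * u₂ < y₁ * y₂ * D
      cross = geometric-mean-< (square-nonNeg u₁) h₁ (square-nonNeg u₂) h₂
        (solve (u₁ ∷ u₂ ∷ [])) (solve (y₁ ∷ y₂ ∷ D ∷ [])) (*-nonNeg (<⇒≤ (*-pos 0<y₁ 0<y₂)) (<⇒≤ 0<D))

    -- u₁ y₂ - u₂ y₁ = y₂ (u₁ + y₁ √D) + (- y₁) (u₂ + y₂ √D) is a positive combination of the summands.
    mixed-cross : ∀ {u₁ y₁ u₂ y₂} → 0ℤ < u₁ → y₁ < 0ℤ → y₁ * y₁ * D < u₁ * u₁ →
                  u₂ < 0ℤ → 0ℤ < y₂ → u₂ * u₂ < y₂ * y₂ * D → u₂ * y₁ < u₁ * y₂
    mixed-cross {u₁} {y₁} {u₂} {y₂} 0<u₁ y₁<0 h₁ u₂<0 0<y₂ h₂ =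
      square-cancel-< (<⇒≤ (*-pos 0<u₁ 0<y₂)) (begin-strict
        (u₂ * y₁) * (u₂ * y₁)     ≡⟨ solve (u₂ ∷ y₁ ∷ []) ⟩
        u₂ * u₂ * (y₁ * y₁)       <⟨ *-monoʳ-<-pos (y₁ * y₁) {{positive (neg*neg y₁<0 y₁<0)}} h₂ ⟩
        y₂ * y₂ * D * (y₁ * y₁)   ≡⟨ solve (y₂ ∷ D ∷ y₁ ∷ []) ⟩
        y₁ * y₁ * D * (y₂ * y₂)   <⟨ *-monoʳ-<-pos (y₂ * y₂) {{positive (*-pos 0<y₂ 0<y₂)}} h₁ ⟩
        u₁ * u₁ * (y₂ * y₂)       ≡⟨ solve (u₁ ∷ y₂ ∷ []) ⟩
        (u₁ * y₂) * (u₁ * y₂)     ∎)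
      where open ≤-Reasoning

    mixed-+ : ∀ {u₁ y₁ u₂ y₂} → 0ℤ < u₁ → y₁ < 0ℤ → y₁ * y₁ * D < u₁ * u₁ →
              u₂ < 0ℤ → 0ℤ < y₂ → u₂ * u₂ < y₂ * y₂ * D → Pos√ (u₁ + u₂) (y₁ + y₂)
    mixed-+ {u₁} {y₁} {u₂} {y₂} 0<u₁ y₁<0 h₁ u₂<0 0<y₂ h₂ with <-cmp (y₁ + y₂) 0ℤ
    ... | tri≈ _ Y≡0 _ = u>0 (0<i*c⇒0<i (neg-mono-< y₁<0) (begin-strict
          0ℤ                                        <⟨ i<j⇒0<j-i (mixed-cross 0<u₁ y₁<0 h₁ u₂<0 0<y₂ h₂) ⟩
          u₁ * y₂ - u₂ * y₁                          ≡⟨ solve (u₁ ∷ y₁ ∷ u₂ ∷ y₂ ∷ []) ⟩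
          (u₁ + u₂) * - y₁ + u₁ * (y₁ + y₂)          ≡⟨ cong (λ t → (u₁ + u₂) * - y₁ + u₁ * t) Y≡0 ⟩
          (u₁ + u₂) * - y₁ + u₁ * 0ℤ                 ≡⟨ solve (u₁ ∷ y₁ ∷ u₂ ∷ []) ⟩
          (u₁ + u₂) * - y₁                           ∎))
        (≤-reflexive (sym Y≡0))
      where open ≤-Reasoning
    ... | tri< Y<0 _ _ = u-dominates 0<U Y<0 (*-cancelʳ-<-square y₁ (begin-strict
          (y₁ + y₂) * (y₁ + y₂) * D * (y₁ * y₁)      ≡⟨ solve (y₁ ∷ y₂ ∷ D ∷ []) ⟩
          y₁ * y₁ * D * ((y₁ + y₂) * (y₁ + y₂))      <⟨ *-monoʳ-<-pos _ {{positive (neg*neg Y<0 Y<0)}} h₁ ⟩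
          u₁ * u₁ * ((y₁ + y₂) * (y₁ + y₂))          ≡⟨ solve (u₁ ∷ y₁ ∷ y₂ ∷ []) ⟩
          (u₁ * - (y₁ + y₂)) * (u₁ * - (y₁ + y₂))    <⟨ square-mono-< (<⇒≤ 0<u₁-Y) step ⟩
          ((u₁ + u₂) * - y₁) * ((u₁ + u₂) * - y₁)    ≡⟨ solve (u₁ ∷ u₂ ∷ y₁ ∷ []) ⟩
          (u₁ + u₂) * (u₁ + u₂) * (y₁ * y₁)          ∎))
      where
      open ≤-Reasoning
      0<u₁-Y : 0ℤ < u₁ * - (y₁ + y₂)
      0<u₁-Y = *-pos 0<u₁ (neg-mono-< Y<0)
      step : u₁ * - (y₁ + y₂) < (u₁ + u₂) * - y₁
      step = <-from-gap (u₁ * y₂ - u₂ * y₁) (solve (u₁ ∷ y₁ ∷ u₂ ∷ y₂ ∷ []))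
        (i<j⇒0<j-i (mixed-cross 0<u₁ y₁<0 h₁ u₂<0 0<y₂ h₂))
      0<U : 0ℤ < u₁ + u₂
      0<U = 0<i*c⇒0<i (neg-mono-< y₁<0) (<-trans 0<u₁-Y step)
    ... | tri> _ _ 0<Y with 0ℤ ≤? u₁ + u₂
    ...   | yes 0≤U = y>0 0≤U 0<Y
    ...   | no  0≰U = y-dominates (≰⇒> 0≰U) 0<Y (*-cancelʳ-<-square y₂ (begin-strict
          (u₁ + u₂) * (u₁ + u₂) * (y₂ * y₂)          ≡⟨ solve (u₁ ∷ u₂ ∷ y₂ ∷ []) ⟩
          (- (u₁ + u₂) * y₂) * (- (u₁ + u₂) * y₂)    <⟨ square-mono-< 0≤-Uy₂ step ⟩
          (- u₂ * (y₁ + y₂)) * (- u₂ * (y₁ + y₂))    ≡⟨ solve (u₂ ∷ y₁ ∷ y₂ ∷ []) ⟩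
          u₂ * u₂ * ((y₁ + y₂) * (y₁ + y₂))          <⟨ *-monoʳ-<-pos _ {{positive (*-pos 0<Y 0<Y)}} h₂ ⟩
          y₂ * y₂ * D * ((y₁ + y₂) * (y₁ + y₂))      ≡⟨ solve (y₁ ∷ y₂ ∷ D ∷ []) ⟩
          (y₁ + y₂) * (y₁ + y₂) * D * (y₂ * y₂)      ∎))
      where
      open ≤-Reasoning
      0≤-Uy₂ : 0ℤ ≤ - (u₁ + u₂) * y₂
      0≤-Uy₂ = *-nonNeg (neg-mono-≤ (<⇒≤ (≰⇒> 0≰U))) (<⇒≤ 0<y₂)
      step : - (u₁ + u₂) * y₂ < - u₂ * (y₁ + y₂)
      step = <-from-gap (u₁ * y₂ - u₂ * y₁) (solve (u₁ ∷ y₁ ∷ u₂ ∷ y₂ ∷ []))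
        (i<j⇒0<j-i (mixed-cross 0<u₁ y₁<0 h₁ u₂<0 0<y₂ h₂))

  Pos√-+ : ∀ {u₁ y₁ u₂ y₂} → Pos√ u₁ y₁ → Pos√ u₂ y₂ → Pos√ (u₁ + u₂) (y₁ + y₂)
  Pos√-+ p (u>0 0<u₂ 0≤y₂) = Pos√-upward p (<⇒≤ 0<u₂) 0≤y₂
  Pos√-+ p (y>0 0≤u₂ 0<y₂) = Pos√-upward p 0≤u₂ (<⇒≤ 0<y₂)
  Pos√-+ {u₁} {y₁} {u₂} {y₂} (u>0 0<u₁ 0≤y₁) q =
    subst₂ Pos√ (+-comm u₂ u₁) (+-comm y₂ y₁) (Pos√-upward q (<⇒≤ 0<u₁) 0≤y₁)
  Pos√-+ {u₁} {y₁} {u₂} {y₂} (y>0 0≤u₁ 0<y₁) q =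
    subst₂ Pos√ (+-comm u₂ u₁) (+-comm y₂ y₁) (Pos√-upward q 0≤u₁ (<⇒≤ 0<y₁))
  Pos√-+ (u-dominates 0<u₁ y₁<0 h₁) (u-dominates 0<u₂ y₂<0 h₂) = u-dominates-+ 0<u₁ y₁<0 h₁ 0<u₂ y₂<0 h₂
  Pos√-+ (y-dominates u₁<0 0<y₁ h₁) (y-dominates u₂<0 0<y₂ h₂) = y-dominates-+ u₁<0 0<y₁ h₁ u₂<0 0<y₂ h₂
  Pos√-+ (u-dominates 0<u₁ y₁<0 h₁) (y-dominates u₂<0 0<y₂ h₂) = mixed-+ 0<u₁ y₁<0 h₁ u₂<0 0<y₂ h₂
  Pos√-+ {u₁} {y₁} {u₂} {y₂} (y-dominates u₁<0 0<y₁ h₁) (u-dominates 0<u₂ y₂<0 h₂) =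
    subst₂ Pos√ (+-comm u₂ u₁) (+-comm y₂ y₁) (mixed-+ 0<u₂ y₂<0 h₂ u₁<0 0<y₁ h₁)

  Pos√-scale : ∀ {c u y} → 0ℤ < c → Pos√ u y → Pos√ (c * u) (c * y)
  Pos√-scale 0<c (u>0 0<u 0≤y) = u>0 (*-pos 0<c 0<u) (*-nonNeg (<⇒≤ 0<c) 0≤y)
  Pos√-scale 0<c (y>0 0≤u 0<y) = y>0 (*-nonNeg (<⇒≤ 0<c) 0≤u) (*-pos 0<c 0<y)
  Pos√-scale {c} {u} {y} 0<c (u-dominates 0<u y<0 h) =
    u-dominates (*-pos 0<c 0<u) (pos*neg 0<c y<0) (begin-strict
      c * y * (c * y) * D  ≡⟨ solve (c ∷ y ∷ D ∷ []) ⟩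
      y * y * D * (c * c)  <⟨ *-monoʳ-<-pos (c * c) {{positive (*-pos 0<c 0<c)}} h ⟩
      u * u * (c * c)      ≡⟨ solve (c ∷ u ∷ []) ⟩
      c * u * (c * u)      ∎)
    where open ≤-Reasoning
  Pos√-scale {c} {u} {y} 0<c (y-dominates u<0 0<y h) =
    y-dominates (pos*neg 0<c u<0) (*-pos 0<c 0<y) (begin-strict
      c * u * (c * u)      ≡⟨ solve (c ∷ u ∷ []) ⟩
      u * u * (c * c)      <⟨ *-monoʳ-<-pos (c * c) {{positive (*-pos 0<c 0<c)}} h ⟩
      y * y * D * (c * c)  ≡⟨ solve (c ∷ y ∷ D ∷ []) ⟩
      c * y * (c * y) * D  ∎)
    where open ≤-Reasoning

  Pos√-unscale : ∀ {c u y} → 0ℤ < c → Pos√ (c * u) (c * y) → Pos√ u y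
  Pos√-unscale 0<c (u>0 0<cu 0≤cy) = u>0 (0<c*i⇒0<i 0<c 0<cu) (0≤c*i⇒0≤i 0<c 0≤cy)
  Pos√-unscale 0<c (y>0 0≤cu 0<cy) = y>0 (0≤c*i⇒0≤i 0<c 0≤cu) (0<c*i⇒0<i 0<c 0<cy)
  Pos√-unscale {c} {u} {y} 0<c (u-dominates 0<cu cy<0 h) =
    u-dominates (0<c*i⇒0<i 0<c 0<cu) (c*i<0⇒i<0 0<c cy<0) (*-cancelʳ-<-square c (begin-strict
      y * y * D * (c * c)  ≡⟨ solve (c ∷ y ∷ D ∷ []) ⟩
      c * y * (c * y) * D  <⟨ h ⟩
      c * u * (c * u)      ≡⟨ solve (c ∷ u ∷ []) ⟩
      u * u * (c * c)      ∎))
    where open ≤-Reasoning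
  Pos√-unscale {c} {u} {y} 0<c (y-dominates cu<0 0<cy h) =
    y-dominates (c*i<0⇒i<0 0<c cu<0) (0<c*i⇒0<i 0<c 0<cy) (*-cancelʳ-<-square c (begin-strict
      u * u * (c * c)      ≡⟨ solve (c ∷ u ∷ []) ⟩
      c * u * (c * u)      <⟨ h ⟩
      c * y * (c * y) * D  ≡⟨ solve (c ∷ y ∷ D ∷ []) ⟩
      y * y * D * (c * c)  ∎))
    where open ≤-Reasoning

  Pos√-√D : ∀ {u y} → Pos√ u y → Pos√ (D * y) u
  Pos√-√D (u>0 0<u 0≤y) = y>0 (*-nonNeg (<⇒≤ 0<D) 0≤y) 0<u
  Pos√-√D (y>0 0≤u 0<y) = u>0 (*-pos 0<D 0<y) 0≤u
  Pos√-√D {u} {y} (u-dominates 0<u y<0 h) = y-dominates (pos*neg 0<D y<0) 0<u (begin-strict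
    D * y * (D * y)  ≡⟨ solve (D ∷ y ∷ []) ⟩
    y * y * D * D    <⟨ *-monoʳ-<-pos D {{positive 0<D}} h ⟩
    u * u * D        ∎)
    where open ≤-Reasoning
  Pos√-√D {u} {y} (y-dominates u<0 0<y h) = u-dominates (*-pos 0<D 0<y) u<0 (begin-strict
    u * u * D        <⟨ *-monoʳ-<-pos D {{positive 0<D}} h ⟩
    y * y * D * D    ≡⟨ solve (D ∷ y ∷ []) ⟩
    D * y * (D * y)  ∎)
    where open ≤-Reasoning

  -- subst₂ Pos√ taking the proof first, so that the solver calls for the equations see both sides.
  Pos√-≡ : ∀ {u y u' y'} → Pos√ u y → u ≡ u' → y ≡ y' → Pos√ u' y'
  Pos√-≡ p refl refl = p

  private
    -- (u₁ + y₁ √D) x = u₁ x + y₁ (√D x)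
    first-quadrant-* : ∀ {u₁ y₁ u₂ y₂} → 0ℤ ≤ u₁ → 0ℤ ≤ y₁ → Pos√ u₁ y₁ → Pos√ u₂ y₂ →
                       Pos√ (u₁ * u₂ + y₁ * y₂ * D) (u₁ * y₂ + y₁ * u₂)
    first-quadrant-* {u₁} {y₁} {u₂} {y₂} 0≤u₁ 0≤y₁ p q with 0ℤ <? u₁ | 0ℤ <? y₁
    ... | yes 0<u₁ | yes 0<y₁ = Pos√-≡ {u' = u₁ * u₂ + y₁ * y₂ * D}
      (Pos√-+ (Pos√-scale 0<u₁ q) (Pos√-scale 0<y₁ (Pos√-√D q))) (solve (u₁ ∷ u₂ ∷ y₁ ∷ y₂ ∷ D ∷ [])) refl
    ... | yes 0<u₁ | no 0≮y₁ = subst (λ t → Pos√ (u₁ * u₂ + t * y₂ * D) (u₁ * y₂ + t * u₂)) (≤∧≮⇒≡ 0≤y₁ 0≮y₁)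
      (Pos√-≡ (Pos√-scale 0<u₁ q) (solve (u₁ ∷ u₂ ∷ y₂ ∷ D ∷ [])) (solve (u₁ ∷ y₂ ∷ u₂ ∷ [])))
    ... | no 0≮u₁ | yes 0<y₁ = subst (λ t → Pos√ (t * u₂ + y₁ * y₂ * D) (t * y₂ + y₁ * u₂)) (≤∧≮⇒≡ 0≤u₁ 0≮u₁)
      (Pos√-≡ (Pos√-scale 0<y₁ (Pos√-√D q)) (solve (u₂ ∷ y₁ ∷ y₂ ∷ D ∷ [])) (solve (y₂ ∷ y₁ ∷ u₂ ∷ [])))
    ... | no 0≮u₁ | no 0≮y₁ = contradiction (subst₂ Pos√ (sym (≤∧≮⇒≡ 0≤u₁ 0≮u₁)) (sym (≤∧≮⇒≡ 0≤y₁ 0≮y₁)) p) ¬Pos√0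

  -- Off the first quadrant the signs of the coordinates of the product are evident, and the
  -- comparison of squares follows from the multiplicativity of the norm u² - y² D.
  Pos√-* : ∀ {u₁ y₁ u₂ y₂} → Pos√ u₁ y₁ → Pos√ u₂ y₂ → Pos√ (u₁ * u₂ + y₁ * y₂ * D) (u₁ * y₂ + y₁ * u₂)
  Pos√-* p@(u>0 0<u₁ 0≤y₁) q = first-quadrant-* (<⇒≤ 0<u₁) 0≤y₁ p q
  Pos√-* p@(y>0 0≤u₁ 0<y₁) q = first-quadrant-* 0≤u₁ (<⇒≤ 0<y₁) p q
  Pos√-* {u₁} {y₁} {u₂} {y₂} p q@(u>0 0<u₂ 0≤y₂) = Pos√-≡ {u' = u₁ * u₂ + y₁ * y₂ * D}
    (first-quadrant-* (<⇒≤ 0<u₂) 0≤y₂ q p) (solve (u₁ ∷ y₁ ∷ u₂ ∷ y₂ ∷ D ∷ [])) (solve (u₁ ∷ y₁ ∷ u₂ ∷ y₂ ∷ []))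
  Pos√-* {u₁} {y₁} {u₂} {y₂} p q@(y>0 0≤u₂ 0<y₂) = Pos√-≡ {u' = u₁ * u₂ + y₁ * y₂ * D}
    (first-quadrant-* 0≤u₂ (<⇒≤ 0<y₂) q p) (solve (u₁ ∷ y₁ ∷ u₂ ∷ y₂ ∷ D ∷ [])) (solve (u₁ ∷ y₁ ∷ u₂ ∷ y₂ ∷ []))
  Pos√-* {u₁} {y₁} {u₂} {y₂} (u-dominates 0<u₁ y₁<0 h₁) (u-dominates 0<u₂ y₂<0 h₂) =
    u-dominates (+-mono-< (*-pos 0<u₁ 0<u₂) (*-pos (neg*neg y₁<0 y₂<0) 0<D))
                (+-mono-< (pos*neg 0<u₁ y₂<0) (neg*pos y₁<0 0<u₂))
                (<-from-gap ((u₁ * u₁ - y₁ * y₁ * D) * (u₂ * u₂ - y₂ * y₂ * D))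
                  (solve (u₁ ∷ y₁ ∷ u₂ ∷ y₂ ∷ D ∷ [])) (*-pos (i<j⇒0<j-i h₁) (i<j⇒0<j-i h₂)))
  Pos√-* {u₁} {y₁} {u₂} {y₂} (y-dominates u₁<0 0<y₁ h₁) (y-dominates u₂<0 0<y₂ h₂) =
    u-dominates (+-mono-< (neg*neg u₁<0 u₂<0) (*-pos (*-pos 0<y₁ 0<y₂) 0<D))
                (+-mono-< (neg*pos u₁<0 0<y₂) (pos*neg 0<y₁ u₂<0))
                (<-from-gap ((y₁ * y₁ * D - u₁ * u₁) * (y₂ * y₂ * D - u₂ * u₂))
                  (solve (u₁ ∷ y₁ ∷ u₂ ∷ y₂ ∷ D ∷ [])) (*-pos (i<j⇒0<j-i h₁) (i<j⇒0<j-i h₂)))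
  Pos√-* {u₁} {y₁} {u₂} {y₂} (u-dominates 0<u₁ y₁<0 h₁) (y-dominates u₂<0 0<y₂ h₂) =
    y-dominates (+-mono-< (pos*neg 0<u₁ u₂<0) (neg*pos (neg*pos y₁<0 0<y₂) 0<D))
                (+-mono-< (*-pos 0<u₁ 0<y₂) (neg*neg y₁<0 u₂<0))
                (<-from-gap ((u₁ * u₁ - y₁ * y₁ * D) * (y₂ * y₂ * D - u₂ * u₂))
                  (solve (u₁ ∷ y₁ ∷ u₂ ∷ y₂ ∷ D ∷ [])) (*-pos (i<j⇒0<j-i h₁) (i<j⇒0<j-i h₂)))
  Pos√-* {u₁} {y₁} {u₂} {y₂} p@(y-dominates _ _ _) q@(u-dominates _ _ _) = Pos√-≡ {u' = u₁ * u₂ + y₁ * y₂ * D}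
    (Pos√-* q p) (solve (u₁ ∷ y₁ ∷ u₂ ∷ y₂ ∷ D ∷ [])) (solve (u₁ ∷ y₁ ∷ u₂ ∷ y₂ ∷ []))

module Zθ-Ring (a : ℕ) where

  open +-*-Solver using (Polynomial; con; _:+_; _:*_; _:-_; :-_; solve; _:=_)

  mulˣ mulʸ : ∀ {n} → Polynomial n → Polynomial n → Polynomial n → Polynomial n → Polynomial n → Polynomial n
  mulˣ A x₁ y₁ x₂ y₂ = x₁ :* x₂ :- y₁ :* y₂
  mulʸ A x₁ y₁ x₂ y₂ = x₁ :* y₂ :+ x₂ :* y₁ :+ A :* (y₁ :* y₂)

  conjˣ : ∀ {n} → Polynomial n → Polynomial n → Polynomial n → Polynomial n
  conjˣ A x₁ y₁ = x₁ :+ A :* y₁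

  Uᵖ : ∀ {n} → Polynomial n → Polynomial n → Polynomial n → Polynomial n
  Uᵖ A x₁ y₁ = con (+ 2) :* x₁ :+ A :* y₁

  A D : ℤ
  A = + a
  D = A ℤ.* A ℤ.- + 4

  -- With θ = (a + √D) / 2 we have 2 α = U α + y α √D.
  U : Zθ → ℤ
  U α = + 2 ℤ.* x α ℤ.+ A ℤ.* y α

  +-assoc : ∀ α β γ → add (add α β) γ ≡ add α (add β γ)
  +-assoc α β γ = cong₂ ⟨_,_⟩ (ℤ.+-assoc (x α) (x β) (x γ)) (ℤ.+-assoc (y α) (y β) (y γ))

  +-comm : ∀ α β → add α β ≡ add β α
  +-comm α β = cong₂ ⟨_,_⟩ (ℤ.+-comm (x α) (x β)) (ℤ.+-comm (y α) (y β))

  +-identityˡ : ∀ α → add zero' α ≡ α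
  +-identityˡ α = cong₂ ⟨_,_⟩ (ℤ.+-identityˡ (x α)) (ℤ.+-identityˡ (y α))

  +-identityʳ : ∀ α → add α zero' ≡ α
  +-identityʳ α = cong₂ ⟨_,_⟩ (ℤ.+-identityʳ (x α)) (ℤ.+-identityʳ (y α))

  -‿inverseˡ : ∀ α → add (neg α) α ≡ zero'
  -‿inverseˡ α = cong₂ ⟨_,_⟩ (ℤ.+-inverseˡ (x α)) (ℤ.+-inverseˡ (y α))

  -‿inverseʳ : ∀ α → add α (neg α) ≡ zero'
  -‿inverseʳ α = cong₂ ⟨_,_⟩ (ℤ.+-inverseʳ (x α)) (ℤ.+-inverseʳ (y α))

  *-comm : ∀ α β → mul a α β ≡ mul a β α
  *-comm ⟨ x₁ , y₁ ⟩ ⟨ x₂ , y₂ ⟩ = cong₂ ⟨_,_⟩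
    (solve 5 (λ A x₁ y₁ x₂ y₂ → mulˣ A x₁ y₁ x₂ y₂ := mulˣ A x₂ y₂ x₁ y₁) refl A x₁ y₁ x₂ y₂)
    (solve 5 (λ A x₁ y₁ x₂ y₂ → mulʸ A x₁ y₁ x₂ y₂ := mulʸ A x₂ y₂ x₁ y₁) refl A x₁ y₁ x₂ y₂)

  *-assoc : ∀ α β γ → mul a (mul a α β) γ ≡ mul a α (mul a β γ)
  *-assoc ⟨ x₁ , y₁ ⟩ ⟨ x₂ , y₂ ⟩ ⟨ x₃ , y₃ ⟩ = cong₂ ⟨_,_⟩
    (solve 7 (λ A x₁ y₁ x₂ y₂ x₃ y₃ →
        mulˣ A (mulˣ A x₁ y₁ x₂ y₂) (mulʸ A x₁ y₁ x₂ y₂) x₃ y₃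
          := mulˣ A x₁ y₁ (mulˣ A x₂ y₂ x₃ y₃) (mulʸ A x₂ y₂ x₃ y₃))
      refl A x₁ y₁ x₂ y₂ x₃ y₃)
    (solve 7 (λ A x₁ y₁ x₂ y₂ x₃ y₃ →
        mulʸ A (mulˣ A x₁ y₁ x₂ y₂) (mulʸ A x₁ y₁ x₂ y₂) x₃ y₃
          := mulʸ A x₁ y₁ (mulˣ A x₂ y₂ x₃ y₃) (mulʸ A x₂ y₂ x₃ y₃))
      refl A x₁ y₁ x₂ y₂ x₃ y₃)

  *-identityˡ : ∀ α → mul a one' α ≡ α
  *-identityˡ ⟨ x₁ , y₁ ⟩ = cong₂ ⟨_,_⟩
    (solve 3 (λ A x₁ y₁ → mulˣ A (con (+ 1)) (con (+ 0)) x₁ y₁ := x₁) refl A x₁ y₁)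
    (solve 3 (λ A x₁ y₁ → mulʸ A (con (+ 1)) (con (+ 0)) x₁ y₁ := y₁) refl A x₁ y₁)

  *-identityʳ : ∀ α → mul a α one' ≡ α
  *-identityʳ α = trans (*-comm α one') (*-identityˡ α)

  distribˡ : ∀ α β γ → mul a α (add β γ) ≡ add (mul a α β) (mul a α γ)
  distribˡ ⟨ x₁ , y₁ ⟩ ⟨ x₂ , y₂ ⟩ ⟨ x₃ , y₃ ⟩ = cong₂ ⟨_,_⟩
    (solve 7 (λ A x₁ y₁ x₂ y₂ x₃ y₃ →
        mulˣ A x₁ y₁ (x₂ :+ x₃) (y₂ :+ y₃) := mulˣ A x₁ y₁ x₂ y₂ :+ mulˣ A x₁ y₁ x₃ y₃) refl A x₁ y₁ x₂ y₂ x₃ y₃)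
    (solve 7 (λ A x₁ y₁ x₂ y₂ x₃ y₃ →
        mulʸ A x₁ y₁ (x₂ :+ x₃) (y₂ :+ y₃) := mulʸ A x₁ y₁ x₂ y₂ :+ mulʸ A x₁ y₁ x₃ y₃) refl A x₁ y₁ x₂ y₂ x₃ y₃)

  distribʳ : ∀ α β γ → mul a (add β γ) α ≡ add (mul a β α) (mul a γ α)
  distribʳ α β γ = begin
    mul a (add β γ) α                ≡⟨ *-comm (add β γ) α ⟩
    mul a α (add β γ)                ≡⟨ distribˡ α β γ ⟩
    add (mul a α β) (mul a α γ)      ≡⟨ cong₂ add (*-comm α β) (*-comm α γ) ⟩
    add (mul a β α) (mul a γ α)      ∎
    where open ≡-Reasoning

  isCommutativeRing : IsCommutativeRing _≡_ add (mul a) neg zero' one'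
  isCommutativeRing = record
    { isRing = record
      { +-isAbelianGroup = record
        { isGroup = record
          { isMonoid = record
            { isSemigroup = record
              { isMagma = record { isEquivalence = isEquivalence ; ∙-cong = cong₂ add }
              ; assoc = +-assoc
              }
            ; identity = +-identityˡ , +-identityʳ
            }
          ; inverse = -‿inverseˡ , -‿inverseʳ
          ; ⁻¹-cong = cong neg
          }
        ; comm = +-comm
        }
      ; *-cong = cong₂ (mul a)
      ; *-assoc = *-assoc
      ; *-identity = *-identityˡ , *-identityʳ
      ; distrib = distribˡ , distribʳ
      }
    ; *-comm = *-comm
    }

  commutativeRing : CommutativeRing 0ℓ 0ℓ
  commutativeRing = record { isCommutativeRing = isCommutativeRing }

  sub-+-sub : ∀ α β γ → add (sub γ β) (sub β α) ≡ sub γ α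
  sub-+-sub α β γ = cong₂ ⟨_,_⟩ (telescope (x α) (x β) (x γ)) (telescope (y α) (y β) (y γ))
    where
    telescope : ∀ i j k → (k ℤ.- j) ℤ.+ (j ℤ.- i) ≡ k ℤ.- i
    telescope = solve-∀

  +-sub-+ : ∀ α β γ → sub (add γ β) (add γ α) ≡ sub β α
  +-sub-+ α β γ = cong₂ ⟨_,_⟩ (cancel (x α) (x β) (x γ)) (cancel (y α) (y β) (y γ))
    where
    cancel : ∀ i j k → (k ℤ.+ j) ℤ.- (k ℤ.+ i) ≡ j ℤ.- i
    cancel = solve-∀

  conj-+ : ∀ α β → conj a (add α β) ≡ add (conj a α) (conj a β)
  conj-+ ⟨ x₁ , y₁ ⟩ ⟨ x₂ , y₂ ⟩ = cong₂ ⟨_,_⟩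
    (solve 5 (λ A x₁ y₁ x₂ y₂ → conjˣ A (x₁ :+ x₂) (y₁ :+ y₂) := conjˣ A x₁ y₁ :+ conjˣ A x₂ y₂) refl A x₁ y₁ x₂ y₂)
    (ℤ.neg-distrib-+ y₁ y₂)

  conj-* : ∀ α β → conj a (mul a α β) ≡ mul a (conj a α) (conj a β)
  conj-* ⟨ x₁ , y₁ ⟩ ⟨ x₂ , y₂ ⟩ = cong₂ ⟨_,_⟩
    (solve 5 (λ A x₁ y₁ x₂ y₂ →
        conjˣ A (mulˣ A x₁ y₁ x₂ y₂) (mulʸ A x₁ y₁ x₂ y₂) := mulˣ A (conjˣ A x₁ y₁) (:- y₁) (conjˣ A x₂ y₂) (:- y₂))
      refl A x₁ y₁ x₂ y₂)
    (solve 5 (λ A x₁ y₁ x₂ y₂ → :- mulʸ A x₁ y₁ x₂ y₂ := mulʸ A (conjˣ A x₁ y₁) (:- y₁) (conjˣ A x₂ y₂) (:- y₂))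
      refl A x₁ y₁ x₂ y₂)

  conj-neg : ∀ α → conj a (neg α) ≡ neg (conj a α)
  conj-neg ⟨ x₁ , y₁ ⟩ = cong₂ ⟨_,_⟩
    (solve 3 (λ A x₁ y₁ → conjˣ A (:- x₁) (:- y₁) := :- conjˣ A x₁ y₁) refl A x₁ y₁) refl

  conj-fromℕ : ∀ n → conj a (fromℕ' n) ≡ fromℕ' n
  conj-fromℕ n = cong₂ ⟨_,_⟩ (trans (cong (ℤ._+_ (+ n)) (ℤ.*-zeroʳ A)) (ℤ.+-identityʳ (+ n))) refl

  conj-θ : conj a θ' ≡ θinv a
  conj-θ = cong₂ ⟨_,_⟩ (trans (ℤ.+-identityˡ (A ℤ.* + 1)) (ℤ.*-identityʳ A)) refl

  conj-θinv : conj a (θinv a) ≡ θ'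
  conj-θinv = cong₂ ⟨_,_⟩ (solve 1 (λ A → conjˣ A A (:- con (+ 1)) := con (+ 0)) refl A) refl

  θ*θinv : mul a θ' (θinv a) ≡ one'
  θ*θinv = cong₂ ⟨_,_⟩
    (solve 1 (λ A → mulˣ A (con (+ 0)) (con (+ 1)) A (:- con (+ 1)) := con (+ 1)) refl A)
    (solve 1 (λ A → mulʸ A (con (+ 0)) (con (+ 1)) A (:- con (+ 1)) := con (+ 0)) refl A)

  U-+ : ∀ α β → U α ℤ.+ U β ≡ U (add α β)
  U-+ ⟨ x₁ , y₁ ⟩ ⟨ x₂ , y₂ ⟩ =
    solve 5 (λ A x₁ y₁ x₂ y₂ → Uᵖ A x₁ y₁ :+ Uᵖ A x₂ y₂ := Uᵖ A (x₁ :+ x₂) (y₁ :+ y₂)) refl A x₁ y₁ x₂ y₂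

  U-* : ∀ α β → U α ℤ.* U β ℤ.+ y α ℤ.* y β ℤ.* D ≡ + 2 ℤ.* U (mul a α β)
  U-* ⟨ x₁ , y₁ ⟩ ⟨ x₂ , y₂ ⟩ =
    solve 5 (λ A x₁ y₁ x₂ y₂ → Uᵖ A x₁ y₁ :* Uᵖ A x₂ y₂ :+ y₁ :* y₂ :* (A :* A :- con (+ 4))
                               := con (+ 2) :* Uᵖ A (mulˣ A x₁ y₁ x₂ y₂) (mulʸ A x₁ y₁ x₂ y₂)) refl A x₁ y₁ x₂ y₂

  y-* : ∀ α β → U α ℤ.* y β ℤ.+ y α ℤ.* U β ≡ + 2 ℤ.* y (mul a α β)
  y-* ⟨ x₁ , y₁ ⟩ ⟨ x₂ , y₂ ⟩ =
    solve 5 (λ A x₁ y₁ x₂ y₂ → Uᵖ A x₁ y₁ :* y₂ :+ y₁ :* Uᵖ A x₂ y₂ := con (+ 2) :* mulʸ A x₁ y₁ x₂ y₂)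
      refl A x₁ y₁ x₂ y₂

  conj-powℕ : ∀ β n → conj a (powℕ a β n) ≡ powℕ a (conj a β) n
  conj-powℕ β zero    = conj-fromℕ 1
  conj-powℕ β (suc n) = trans (conj-* β (powℕ a β n)) (cong (mul a (conj a β)) (conj-powℕ β n))

  conj-θ^ : ∀ p → conj a (θ^ a p) ≡ θ^ a (ℤ.- p)
  conj-θ^ (+ zero)  = conj-fromℕ 1
  conj-θ^ (+ suc n) = trans (conj-powℕ θ' (suc n)) (cong (λ β → powℕ a β (suc n)) conj-θ)
  conj-θ^ -[1+ n ]  = trans (conj-powℕ (θinv a) (suc n)) (cong (λ β → powℕ a β (suc n)) conj-θinv)

  θinv*θ : mul a (θinv a) θ' ≡ one'
  θinv*θ = trans (*-comm (θinv a) θ') θ*θinv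

  private
    cancel-θ*θinv : ∀ β → mul a θ' (mul a (θinv a) β) ≡ β
    cancel-θ*θinv β = begin
      mul a θ' (mul a (θinv a) β)   ≡⟨ *-assoc θ' (θinv a) β ⟨
      mul a (mul a θ' (θinv a)) β   ≡⟨ cong (λ γ → mul a γ β) θ*θinv ⟩
      mul a one' β                  ≡⟨ *-identityˡ β ⟩
      β                             ∎
      where open ≡-Reasoning

    cancel-θinv*θ : ∀ β → mul a (θinv a) (mul a θ' β) ≡ β
    cancel-θinv*θ β = begin
      mul a (θinv a) (mul a θ' β)   ≡⟨ *-assoc (θinv a) θ' β ⟨
      mul a (mul a (θinv a) θ') β   ≡⟨ cong (λ γ → mul a γ β) θinv*θ ⟩
      mul a one' β                  ≡⟨ *-identityˡ β ⟩
      β                             ∎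
      where open ≡-Reasoning

  θ^-suc : ∀ p → θ^ a (ℤ.1ℤ ℤ.+ p) ≡ mul a θ' (θ^ a p)
  θ^-suc (+ n)            = refl
  θ^-suc -[1+ zero ]      = sym (trans (cong (mul a θ') (*-identityʳ (θinv a))) θ*θinv)
  θ^-suc -[1+ suc n ]     = sym (cancel-θ*θinv (θ^ a -[1+ n ]))

  θ^-pred : ∀ p → θ^ a (ℤ.-1ℤ ℤ.+ p) ≡ mul a (θinv a) (θ^ a p)
  θ^-pred p = begin
    θ^ a (ℤ.-1ℤ ℤ.+ p)                          ≡⟨ cancel-θinv*θ _ ⟨
    mul a (θinv a) (mul a θ' (θ^ a (ℤ.-1ℤ ℤ.+ p)))  ≡⟨ cong (mul a (θinv a)) (θ^-suc (ℤ.-1ℤ ℤ.+ p)) ⟨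
    mul a (θinv a) (θ^ a (ℤ.1ℤ ℤ.+ (ℤ.-1ℤ ℤ.+ p)))  ≡⟨ cong (λ q → mul a (θinv a) (θ^ a q)) (ℤ.suc-pred p) ⟩
    mul a (θinv a) (θ^ a p)                     ∎
    where open ≡-Reasoning

  θ^-+ : ∀ p q → θ^ a (p ℤ.+ q) ≡ mul a (θ^ a p) (θ^ a q)
  θ^-+ (+ zero) q = trans (cong (θ^ a) (ℤ.+-identityˡ q)) (sym (*-identityˡ (θ^ a q)))
  θ^-+ (+ suc n) q = begin
    θ^ a (+ suc n ℤ.+ q)                        ≡⟨ cong (θ^ a) (ℤ.+-assoc ℤ.1ℤ (+ n) q) ⟩
    θ^ a (ℤ.1ℤ ℤ.+ (+ n ℤ.+ q))                 ≡⟨ θ^-suc (+ n ℤ.+ q) ⟩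
    mul a θ' (θ^ a (+ n ℤ.+ q))                 ≡⟨ cong (mul a θ') (θ^-+ (+ n) q) ⟩
    mul a θ' (mul a (θ^ a (+ n)) (θ^ a q))      ≡⟨ *-assoc θ' (θ^ a (+ n)) (θ^ a q) ⟨
    mul a (θ^ a (+ suc n)) (θ^ a q)             ∎
    where open ≡-Reasoning
  θ^-+ -[1+ zero ] q = begin
    θ^ a (ℤ.-1ℤ ℤ.+ q)                          ≡⟨ θ^-pred q ⟩
    mul a (θinv a) (θ^ a q)                     ≡⟨ cong (λ β → mul a β (θ^ a q)) (*-identityʳ (θinv a)) ⟨
    mul a (θ^ a -[1+ zero ]) (θ^ a q)           ∎
    where open ≡-Reasoning
  θ^-+ -[1+ suc n ] q = begin
    θ^ a (-[1+ suc n ] ℤ.+ q)                   ≡⟨ cong (θ^ a) (ℤ.+-assoc ℤ.-1ℤ -[1+ n ] q) ⟩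
    θ^ a (ℤ.-1ℤ ℤ.+ (-[1+ n ] ℤ.+ q))           ≡⟨ θ^-pred (-[1+ n ] ℤ.+ q) ⟩
    mul a (θinv a) (θ^ a (-[1+ n ] ℤ.+ q))      ≡⟨ cong (mul a (θinv a)) (θ^-+ -[1+ n ] q) ⟩
    mul a (θinv a) (mul a (θ^ a -[1+ n ]) (θ^ a q))  ≡⟨ *-assoc (θinv a) (θ^ a -[1+ n ]) (θ^ a q) ⟨
    mul a (θ^ a -[1+ suc n ]) (θ^ a q)          ∎
    where open ≡-Reasoning

  +-sub-cancelˡ : ∀ α β → sub (add α β) α ≡ β
  +-sub-cancelˡ α β = cong₂ ⟨_,_⟩ (cancel (x α) (x β)) (cancel (y α) (y β))
    where
    cancel : ∀ i j → (i ℤ.+ j) ℤ.- i ≡ j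
    cancel = solve-∀

  U-θinv : U (θinv a) ≡ A
  U-θinv = solve 1 (λ A → Uᵖ A A (:- con (+ 1)) := A) refl A

  U-fromℕ : ∀ n → U (fromℕ' n) ≡ + 2 ℤ.* + n
  U-fromℕ n = trans (cong (ℤ._+_ (+ 2 ℤ.* + n)) (ℤ.*-zeroʳ A)) (ℤ.+-identityʳ (+ 2 ℤ.* + n))

  -‿involutive : ∀ α → neg (neg α) ≡ α
  -‿involutive α = cong₂ ⟨_,_⟩ (ℤ.neg-involutive (x α)) (ℤ.neg-involutive (y α))

module QuadraticUnit (k : ℕ) where

  -- a = k + 3, so that the digits a ∸ 1 and a ∸ 2 of Defs compute to suc (suc k) and suc k.
  a : ℕ
  a = 3 ℕ.+ k

  open Zθ-Ring a
  open IntegerInequalities using (<-from-gap; i<j⇒0<j-i)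
  open +-*-Solver using (Polynomial; con; _:+_; _:*_; _:-_; :-_; solve; _:=_)

  private
    A+K : ∀ {n} → Polynomial n → Polynomial n
    A+K K = con (+ 3) :+ K

  0<D : 0ℤ ℤ.< D
  0<D = subst (0ℤ ℤ.<_) (sym D≡[a-2][a+2]) (ℤ.+<+ (ℕ.s≤s ℕ.z≤n))
    where
    D≡[a-2][a+2] : D ≡ + (suc k) ℤ.* + (5 ℕ.+ k)
    D≡[a-2][a+2] = solve 1 (λ K → A+K K :* A+K K :- con (+ 4) := (con (+ 1) :+ K) :* (con (+ 5) :+ K)) refl (+ k)

  open SqrtCone D 0<D
  open CommutativeRing commutativeRing using (_+_; _*_; -_; _-_; ring; zeroˡ; zeroʳ; *-commutativeSemigroup)
  open CommutativeSemigroupProperties *-commutativeSemigroup using (x∙yz≈y∙xz) renaming (interchange to *-interchange)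
  open CommutativeSemigroupProperties Sign.*-commutativeSemigroup using () renaming (interchange to sign-interchange)
  open RingProperties ring using (x[y-z]≈xy-xz; -‿distribˡ-*; -‿distribʳ-*)

  -- Positivity and the order of ℤ[θ]

  Pos⇒Pos√ : ∀ {α} → Pos a α → Pos√ (U α) (y α)
  Pos⇒Pos√ (inj₁ (0<u , 0≤y))                     = u>0 0<u 0≤y
  Pos⇒Pos√ (inj₂ (inj₁ (0≤u , 0<y)))              = y>0 0≤u 0<y
  Pos⇒Pos√ (inj₂ (inj₂ (inj₁ (0<u , y<0 , h))))   = u-dominates 0<u y<0 h
  Pos⇒Pos√ (inj₂ (inj₂ (inj₂ (u<0 , 0<y , h))))   = y-dominates u<0 0<y h

  Pos√⇒Pos : ∀ {α} → Pos√ (U α) (y α) → Pos a α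
  Pos√⇒Pos (u>0 0<u 0≤y)           = inj₁ (0<u , 0≤y)
  Pos√⇒Pos (y>0 0≤u 0<y)           = inj₂ (inj₁ (0≤u , 0<y))
  Pos√⇒Pos (u-dominates 0<u y<0 h) = inj₂ (inj₂ (inj₁ (0<u , y<0 , h)))
  Pos√⇒Pos (y-dominates u<0 0<y h) = inj₂ (inj₂ (inj₂ (u<0 , 0<y , h)))

  ¬Pos-0 : ¬ Pos a zero'
  ¬Pos-0 p = ¬Pos√0 (subst₂ Pos√ (trans (ℤ.+-identityˡ (A ℤ.* 0ℤ)) (ℤ.*-zeroʳ A)) refl (Pos⇒Pos√ {zero'} p))

  Pos-+ : ∀ {α β} → Pos a α → Pos a β → Pos a (α + β)
  Pos-+ {α} {β} p q = Pos√⇒Pos {α + β} (Pos√-≡ (Pos√-+ (Pos⇒Pos√ {α} p) (Pos⇒Pos√ {β} q)) (U-+ α β) refl)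

  Pos-* : ∀ {α β} → Pos a α → Pos a β → Pos a (α * β)
  Pos-* {α} {β} p q = Pos√⇒Pos {α * β} (Pos√-unscale {c = + 2} (ℤ.+<+ (ℕ.s≤s ℕ.z≤n))
    (Pos√-≡ (Pos√-* (Pos⇒Pos√ {α} p) (Pos⇒Pos√ {β} q)) (U-* α β) (y-* α β)))

  infix 4 _<_ _≤_

  -- A record rather than Pos a (β - α), so that α and β can be inferred from a proof.
  record _<_ (α β : Zθ) : Set where
    constructor by-Pos
    field Pos-gap : Pos a (β - α)
  open _<_

  _≤_ : Zθ → Zθ → Set
  α ≤ β = α ≡ β ⊎ α < β

  Pos⇒0< : ∀ {α} → Pos a α → zero' < α
  Pos⇒0< {α} p = by-Pos (subst (Pos a) (sym (+-identityʳ α)) p)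

  0<⇒Pos : ∀ {α} → zero' < α → Pos a α
  0<⇒Pos {α} (by-Pos p) = subst (Pos a) (+-identityʳ α) p

  <⇒0<- : ∀ {α β} → α < β → zero' < β - α
  <⇒0<- (by-Pos p) = Pos⇒0< p

  <-irrefl : ∀ {α} → ¬ α < α
  <-irrefl {α} (by-Pos p) = ¬Pos-0 (subst (Pos a) (-‿inverseʳ α) p)

  <-trans : ∀ {α β γ} → α < β → β < γ → α < γ
  <-trans {α} {β} {γ} (by-Pos p) (by-Pos q) = by-Pos (subst (Pos a) (sub-+-sub α β γ) (Pos-+ {γ - β} {β - α} q p))

  <-asym : ∀ {α β} → α < β → ¬ β < α
  <-asym α<β β<α = <-irrefl (<-trans α<β β<α)

  <⇒≤ : ∀ {α β} → α < β → α ≤ β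
  <⇒≤ = inj₂

  <-≤-trans : ∀ {α β γ} → α < β → β ≤ γ → α < γ
  <-≤-trans α<β (inj₁ refl) = α<β
  <-≤-trans α<β (inj₂ β<γ)  = <-trans α<β β<γ

  ≤-<-trans : ∀ {α β γ} → α ≤ β → β < γ → α < γ
  ≤-<-trans (inj₁ refl) β<γ = β<γ
  ≤-<-trans (inj₂ α<β)  β<γ = <-trans α<β β<γ

  ≤-trans : ∀ {α β γ} → α ≤ β → β ≤ γ → α ≤ γ
  ≤-trans (inj₁ refl) β≤γ = β≤γ
  ≤-trans (inj₂ α<β)  β≤γ = inj₂ (<-≤-trans α<β β≤γ)

  ≤-isPreorder : IsPreorder _≡_ _≤_
  ≤-isPreorder = record { isEquivalence = isEquivalence ; reflexive = inj₁ ; trans = ≤-trans }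

  module ≤-Reasoning = Triple ≤-isPreorder <-asym <-trans (resp₂ _<_) <⇒≤ <-≤-trans ≤-<-trans

  +-monoʳ-< : ∀ {α β} γ → α < β → γ + α < γ + β
  +-monoʳ-< {α} {β} γ (by-Pos p) = by-Pos (subst (Pos a) (sym (+-sub-+ α β γ)) p)

  +-monoʳ-≤ : ∀ {α β} γ → α ≤ β → γ + α ≤ γ + β
  +-monoʳ-≤ γ (inj₁ refl) = inj₁ refl
  +-monoʳ-≤ γ (inj₂ α<β)  = inj₂ (+-monoʳ-< γ α<β)

  +-mono-≤ : ∀ {α β γ δ} → α ≤ β → γ ≤ δ → α + γ ≤ β + δ
  +-mono-≤ {α} {β} {γ} {δ} α≤β γ≤δ =
    ≤-trans (subst₂ _≤_ (+-comm γ α) (+-comm γ β) (+-monoʳ-≤ γ α≤β)) (+-monoʳ-≤ β γ≤δ)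

  α<α+β : ∀ {α β} → zero' < β → α < α + β
  α<α+β {α} {β} 0<β = by-Pos (subst (Pos a) (sym (+-sub-cancelˡ α β)) (0<⇒Pos 0<β))

  *-pos : ∀ {α β} → zero' < α → zero' < β → zero' < α * β
  *-pos {α} {β} 0<α 0<β = Pos⇒0< {α * β} (Pos-* {α} {β} (0<⇒Pos 0<α) (0<⇒Pos 0<β))

  *-monoˡ-< : ∀ {α β γ} → zero' < γ → α < β → γ * α < γ * β
  *-monoˡ-< {α} {β} {γ} 0<γ (by-Pos p) =
    by-Pos (subst (Pos a) (x[y-z]≈xy-xz γ β α) (Pos-* {γ} {β - α} (0<⇒Pos 0<γ) p))

  *-monoʳ-< : ∀ {α β γ} → zero' < γ → α < β → α * γ < β * γ
  *-monoʳ-< {α} {β} {γ} 0<γ α<β = subst₂ _<_ (*-comm γ α) (*-comm γ β) (*-monoˡ-< 0<γ α<β)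

  *-monoˡ-≤ : ∀ {α β γ} → zero' < γ → α ≤ β → γ * α ≤ γ * β
  *-monoˡ-≤ 0<γ (inj₁ refl) = inj₁ refl
  *-monoˡ-≤ 0<γ (inj₂ α<β)  = inj₂ (*-monoˡ-< 0<γ α<β)

  *-monoʳ-≤ : ∀ {α β γ} → zero' < γ → α ≤ β → α * γ ≤ β * γ
  *-monoʳ-≤ 0<γ (inj₁ refl) = inj₁ refl
  *-monoʳ-≤ 0<γ (inj₂ α<β)  = inj₂ (*-monoʳ-< 0<γ α<β)

  Pos-fromℕ : ∀ n → Pos a (fromℕ' (suc n))
  Pos-fromℕ n = Pos√⇒Pos {fromℕ' (suc n)}
    (Pos√-≡ (u>0 (ℤ.+<+ (ℕ.s≤s ℕ.z≤n)) (ℤ.+≤+ ℕ.z≤n)) (sym (U-fromℕ (suc n))) refl)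

  0<1 : zero' < one'
  0<1 = Pos⇒0< {one'} (Pos-fromℕ 0)

  Pos-θ : Pos a θ'
  Pos-θ = inj₁ (ℤ.+<+ (ℕ.s≤s ℕ.z≤n) , ℤ.+≤+ ℕ.z≤n)

  0<θ : zero' < θ'
  0<θ = Pos⇒0< {θ'} Pos-θ

  Pos-θinv : Pos a (θinv a)
  Pos-θinv = Pos√⇒Pos {θinv a} (Pos√-≡ (u-dominates (ℤ.+<+ (ℕ.s≤s ℕ.z≤n)) ℤ.-<+ D<A*A) (sym U-θinv) refl)
    where
    D<A*A : + 1 ℤ.* D ℤ.< A ℤ.* A
    D<A*A = <-from-gap (+ 4) (square≡D+4 A) (ℤ.+<+ (ℕ.s≤s ℕ.z≤n))
      where
      square≡D+4 : ∀ A → A ℤ.* A ≡ + 1 ℤ.* (A ℤ.* A ℤ.- + 4) ℤ.+ + 4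
      square≡D+4 = solve-∀

  0<θinv : zero' < θinv a
  0<θinv = Pos⇒0< {θinv a} Pos-θinv

  fromℕ-< : ∀ {m n} → m ℕ.< n → fromℕ' m < fromℕ' n
  fromℕ-< {m} (ℕ.s≤s m≤n) with ℕ.m≤n⇒∃[o]m+o≡n m≤n
  ... | d , refl =
    subst (fromℕ' m <_) (cong fromℕ' (ℕ.+-suc m d)) (α<α+β (Pos⇒0< {fromℕ' (suc d)} (Pos-fromℕ d)))

  fromℕ-≤ : ∀ {m n} → m ℕ.≤ n → fromℕ' m ≤ fromℕ' n
  fromℕ-≤ m≤n with ℕ.m≤n⇒m<n∨m≡n m≤n
  ... | inj₁ m<n  = inj₂ (fromℕ-< m<n)
  ... | inj₂ refl = inj₁ refl

  0≤fromℕ : ∀ n → zero' ≤ fromℕ' n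
  0≤fromℕ n = fromℕ-≤ ℕ.z≤n

  -- θ - (a - 1) has U = - (a - 2) and y = 1, and (a - 2)² < D = (a - 2) (a + 2).
  a-1<θ : fromℕ' (suc (suc k)) < θ'
  a-1<θ = by-Pos (Pos√⇒Pos {θ' - fromℕ' (suc (suc k))} (Pos√-≡
    (y-dominates ℤ.-<+ (ℤ.+<+ (ℕ.s≤s ℕ.z≤n)) (<-from-gap (+ 4 ℤ.* + suc k) gap (ℤ.+<+ (ℕ.s≤s ℕ.z≤n))))
    (sym U≡) refl))
    where
    U≡ : U (θ' - fromℕ' (suc (suc k))) ≡ -[1+ k ]
    U≡ = solve 1 (λ K → Uᵖ (A+K K) (con (+ 0) :- (con (+ 2) :+ K)) (con (+ 1) :- con (+ 0)) := :- (con (+ 1) :+ K))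
      refl (+ k)
    gap : + 1 ℤ.* + 1 ℤ.* D ≡ -[1+ k ] ℤ.* -[1+ k ] ℤ.+ + 4 ℤ.* + suc k
    gap = solve 1 (λ K → con (+ 1) :* con (+ 1) :* (A+K K :* A+K K :- con (+ 4))
                      := (:- (con (+ 1) :+ K)) :* (:- (con (+ 1) :+ K)) :+ con (+ 4) :* (con (+ 1) :+ K)) refl (+ k)

  1<θ : one' < θ'
  1<θ = <-trans (fromℕ-< (ℕ.s≤s (ℕ.s≤s ℕ.z≤n))) a-1<θ

  0<T : zero' < T'
  0<T = <⇒0<- 1<θ

  -- T - (a - 2) and θ - (a - 1) are the same element of ℤ[θ].
  a-2<T : fromℕ' (suc k) < T'
  a-2<T = by-Pos (Pos-gap a-1<θ)

  private
    θinv*Tˣ θinv*Tʸ : ∀ {n} → Polynomial n → Polynomial n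
    θinv*Tˣ K = mulˣ (A+K K) (A+K K) (:- con (+ 1)) (:- con (+ 1)) (con (+ 1))
    θinv*Tʸ K = mulʸ (A+K K) (A+K K) (:- con (+ 1)) (:- con (+ 1)) (con (+ 1))

  [a-1]+θinv*T≡θ : fromℕ' (suc (suc k)) + θinv a * T' ≡ θ'
  [a-1]+θinv*T≡θ = cong₂ ⟨_,_⟩
    (solve 1 (λ K → (con (+ 2) :+ K) :+ θinv*Tˣ K := con (+ 0)) refl (+ k))
    (solve 1 (λ K → con (+ 0) :+ θinv*Tʸ K := con (+ 1)) refl (+ k))

  [a-2]+θinv*T≡T : fromℕ' (suc k) + θinv a * T' ≡ T'
  [a-2]+θinv*T≡T = cong₂ ⟨_,_⟩
    (solve 1 (λ K → (con (+ 1) :+ K) :+ θinv*Tˣ K := :- con (+ 1)) refl (+ k))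
    (solve 1 (λ K → con (+ 0) :+ θinv*Tʸ K := con (+ 1)) refl (+ k))

  b+θinv*θ≡b+1 : ∀ b → fromℕ' b + θinv a * θ' ≡ fromℕ' (suc b)
  b+θinv*θ≡b+1 b = trans (cong (_+_ (fromℕ' b)) θinv*θ) (cong₂ ⟨_,_⟩ (cong +_ (ℕ.+-comm b 1)) refl)

  T*T≡[a-2]θ : T' * T' ≡ fromℕ' (suc k) * θ'
  T*T≡[a-2]θ = cong₂ ⟨_,_⟩
    (solve 1 (λ K → mulˣ (A+K K) (:- con (+ 1)) (con (+ 1)) (:- con (+ 1)) (con (+ 1))
                  := mulˣ (A+K K) (con (+ 1) :+ K) (con (+ 0)) (con (+ 0)) (con (+ 1))) refl (+ k))
    (solve 1 (λ K → mulʸ (A+K K) (:- con (+ 1)) (con (+ 1)) (:- con (+ 1)) (con (+ 1))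
                  := mulʸ (A+K K) (con (+ 1) :+ K) (con (+ 0)) (con (+ 0)) (con (+ 1))) refl (+ k))

  Pos-powℕ : ∀ {β} n → Pos a β → Pos a (powℕ a β n)
  Pos-powℕ zero    p = Pos-fromℕ 0
  Pos-powℕ {β} (suc n) p = Pos-* {β} {powℕ a β n} p (Pos-powℕ n p)

  0<θ^ : ∀ p → zero' < θ^ a p
  0<θ^ (+ n)     = Pos⇒0< (Pos-powℕ {θ'} n Pos-θ)
  0<θ^ -[1+ n ]  = Pos⇒0< (Pos-powℕ {θinv a} (suc n) Pos-θinv)

  1<θ^suc : ∀ n → one' < θ^ a (+ suc n)
  1<θ^suc zero    = subst (one' <_) (sym (*-identityʳ θ')) 1<θ
  1<θ^suc (suc n) = begin-strict
    one'                      <⟨ 1<θ ⟩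
    θ'                        ≡⟨ *-identityʳ θ' ⟨
    θ' * one'                 <⟨ *-monoˡ-< (0<θ) (1<θ^suc n) ⟩
    θ' * θ^ a (+ suc n)       ∎
    where open ≤-Reasoning

  θ^-mono-< : ∀ {p q} → p ℤ.< q → θ^ a p < θ^ a q
  θ^-mono-< {p} {q} p<q with q ℤ.- p in q-p≡ | i<j⇒0<j-i p<q
  ... | +[1+ n ] | _ = begin-strict
    θ^ a p                          ≡⟨ *-identityʳ (θ^ a p) ⟨
    θ^ a p * one'                   <⟨ *-monoˡ-< (0<θ^ p) (1<θ^suc n) ⟩
    θ^ a p * θ^ a (+ suc n)         ≡⟨ θ^-+ p (+ suc n) ⟨
    θ^ a (p ℤ.+ + suc n)            ≡⟨ cong (λ d → θ^ a (p ℤ.+ d)) q-p≡ ⟨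
    θ^ a (p ℤ.+ (q ℤ.- p))          ≡⟨ cong (θ^ a) (p+[q-p]≡q p q) ⟩
    θ^ a q                          ∎
    where
    open ≤-Reasoning
    p+[q-p]≡q : ∀ p q → p ℤ.+ (q ℤ.- p) ≡ q
    p+[q-p]≡q = solve-∀

  ... | +0       | ℤ.+<+ ()
  ... | -[1+ _ ] | ()

  θ^-mono-≤ : ∀ {p q} → p ℤ.≤ q → θ^ a p ≤ θ^ a q
  θ^-mono-≤ {p} {q} p≤q with p ℤ.<? q
  ... | yes p<q = inj₂ (θ^-mono-< p<q)
  ... | no  p≮q = inj₁ (cong (θ^ a) (ℤ.≤∧≮⇒≡ p≤q p≮q))

  θ^-cancel-< : ∀ {p q} → θ^ a p < θ^ a q → p ℤ.< q
  θ^-cancel-< {p} {q} θ^p<θ^q with p ℤ.<? q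
  ... | yes p<q = p<q
  ... | no  p≮q = contradiction (≤-<-trans (θ^-mono-≤ (ℤ.≮⇒≥ p≮q)) θ^p<θ^q) <-irrefl

  -- Conjugates of greedy expansions

  conj-evalDigits-∷ : ∀ b bs → conj a (evalDigits a (b ∷ bs)) ≡ fromℕ' b + θinv a * conj a (evalDigits a bs)
  conj-evalDigits-∷ b bs = begin
    conj a (fromℕ' b + θ' * E)              ≡⟨ conj-+ (fromℕ' b) (θ' * E) ⟩
    conj a (fromℕ' b) + conj a (θ' * E)     ≡⟨ cong₂ _+_ (conj-fromℕ b) (conj-* θ' E) ⟩
    fromℕ' b + conj a θ' * conj a E         ≡⟨ cong (λ β → fromℕ' b + β * conj a E) conj-θ ⟩
    fromℕ' b + θinv a * conj a E            ∎
    where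
    open ≡-Reasoning
    E : Zθ
    E = evalDigits a bs

  0≤θinv* : ∀ {ρ} → zero' ≤ ρ → zero' ≤ θinv a * ρ
  0≤θinv* {ρ} 0≤ρ = subst (_≤ θinv a * ρ) (zeroʳ (θinv a)) (*-monoˡ-≤ (0<θinv) 0≤ρ)

  0≤conj-evalDigits : ∀ ds → zero' ≤ conj a (evalDigits a ds)
  0≤conj-evalDigits []       = inj₁ (sym (conj-fromℕ 0))
  0≤conj-evalDigits (b ∷ bs) = subst (zero' ≤_) (sym (conj-evalDigits-∷ b bs))
    (+-mono-≤ (0≤fromℕ b) (0≤θinv* (0≤conj-evalDigits bs)))

  1≤conj-evalDigits : ∀ {b} bs → b ≢ 0 → one' ≤ conj a (evalDigits a (b ∷ bs))
  1≤conj-evalDigits {b} bs b≢0 = subst (one' ≤_) (sym (conj-evalDigits-∷ b bs))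
    (+-mono-≤ (fromℕ-≤ (ℕ.n≢0⇒n>0 b≢0)) (0≤θinv* (0≤conj-evalDigits bs)))

  digit-step-< : ∀ b {ε ε'} → ε < ε' → fromℕ' b + θinv a * ε < fromℕ' b + θinv a * ε'
  digit-step-< b ε<ε' = +-monoʳ-< (fromℕ' b) (*-monoˡ-< (0<θinv) ε<ε')

  digit-cases : ∀ {b} → b ℕ.< a → b ≡ suc (suc k) ⊎ b ≡ suc k ⊎ b ℕ.≤ k
  digit-cases (ℕ.s≤s b≤a-1) with ℕ.m≤n⇒m<n∨m≡n b≤a-1
  ... | inj₂ b≡a-1 = inj₁ b≡a-1
  ... | inj₁ (ℕ.s≤s b≤a-2) with ℕ.m≤n⇒m<n∨m≡n b≤a-2
  ...   | inj₂ b≡a-2           = inj₂ (inj₁ b≡a-2)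
  ...   | inj₁ (ℕ.s≤s b≤a-3)   = inj₂ (inj₂ b≤a-3)

  StartsWithForbidden : List ℕ → Set
  StartsWithForbidden ds = Σ ℕ λ n → Σ (List ℕ) λ rest → ds ≡ ForbiddenWord a n ++ rest

  HasForbidden-∷ : ∀ {b bs} → HasForbidden a bs → HasForbidden a (b ∷ bs)
  HasForbidden-∷ {b} (n , pre , suf , eq) = n , b ∷ pre , suf , cong (b ∷_) eq

  StartsWithForbidden⇒HasForbidden : ∀ {ds} → StartsWithForbidden ds → HasForbidden a ds
  StartsWithForbidden⇒HasForbidden (n , rest , eq) = n , [] , rest , eq

  StartsWithForbidden-∷ : ∀ {bs} → StartsWithForbidden (suc (suc k) ∷ bs) →
                          StartsWithForbidden (suc (suc k) ∷ suc k ∷ bs)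
  StartsWithForbidden-∷ (n , rest , eq) = suc n , rest , cong (λ t → suc (suc k) ∷ suc k ∷ t) (∷-injectiveʳ eq)

  -- Since (a - 1) + θ⁻¹ T = θ, the digits following a digit a - 1 need the sharper bound T = θ - 1;
  -- they cannot open with (a - 2)ⁿ (a - 1), which would complete a forbidden word.
  conj-evalDigits<θ : ∀ ds → AllDigits a ds → ¬ HasForbidden a ds → conj a (evalDigits a ds) < θ'
  conj-evalDigits<T : ∀ ds → AllDigits a ds → ¬ HasForbidden a ds → ¬ StartsWithForbidden (suc (suc k) ∷ ds) →
                      conj a (evalDigits a ds) < T'

  conj-evalDigits<θ [] _ _ = subst (_< θ') (sym (conj-fromℕ 0)) (0<θ)
  conj-evalDigits<θ (b ∷ bs) (b<a , digits) free with digit-cases b<a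
  ... | inj₁ refl = begin-strict
    conj a (evalDigits a (b ∷ bs))                ≡⟨ conj-evalDigits-∷ b bs ⟩
    fromℕ' b + θinv a * conj a (evalDigits a bs)  <⟨ digit-step-< b (conj-evalDigits<T bs digits
                                                       (free ∘ HasForbidden-∷)
                                                       (free ∘ StartsWithForbidden⇒HasForbidden)) ⟩
    fromℕ' b + θinv a * T'                        ≡⟨ [a-1]+θinv*T≡θ ⟩
    θ'                                            ∎
    where open ≤-Reasoning
  ... | inj₂ b≤a-2 = begin-strict
    conj a (evalDigits a (b ∷ bs))                ≡⟨ conj-evalDigits-∷ b bs ⟩
    fromℕ' b + θinv a * conj a (evalDigits a bs)  <⟨ digit-step-< b (conj-evalDigits<θ bs digits
                                                       (free ∘ HasForbidden-∷)) ⟩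
    fromℕ' b + θinv a * θ'                        ≡⟨ b+θinv*θ≡b+1 b ⟩
    fromℕ' (suc b)                                ≤⟨ fromℕ-≤ (ℕ.s≤s b≤suc-k) ⟩
    fromℕ' (suc (suc k))                          <⟨ a-1<θ ⟩
    θ'                                            ∎
    where
    open ≤-Reasoning
    b≤suc-k : b ℕ.≤ suc k
    b≤suc-k = [ ℕ.≤-reflexive , ℕ.m≤n⇒m≤1+n ] b≤a-2

  conj-evalDigits<T [] _ _ _ = subst (_< T') (sym (conj-fromℕ 0)) 0<T
  conj-evalDigits<T (b ∷ bs) (b<a , digits) free opens with digit-cases b<a
  ... | inj₁ refl = contradiction (0 , bs , refl) opens
  ... | inj₂ (inj₁ refl) = begin-strict
    conj a (evalDigits a (b ∷ bs))                ≡⟨ conj-evalDigits-∷ b bs ⟩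
    fromℕ' b + θinv a * conj a (evalDigits a bs)  <⟨ digit-step-< b (conj-evalDigits<T bs digits
                                                       (free ∘ HasForbidden-∷) (opens ∘ StartsWithForbidden-∷)) ⟩
    fromℕ' b + θinv a * T'                        ≡⟨ [a-2]+θinv*T≡T ⟩
    T'                                            ∎
    where open ≤-Reasoning
  ... | inj₂ (inj₂ b≤k) = begin-strict
    conj a (evalDigits a (b ∷ bs))                ≡⟨ conj-evalDigits-∷ b bs ⟩
    fromℕ' b + θinv a * conj a (evalDigits a bs)  <⟨ digit-step-< b (conj-evalDigits<θ bs digits
                                                       (free ∘ HasForbidden-∷)) ⟩
    fromℕ' b + θinv a * θ'                        ≡⟨ b+θinv*θ≡b+1 b ⟩
    fromℕ' (suc b)                                ≤⟨ fromℕ-≤ (ℕ.s≤s b≤k) ⟩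
    fromℕ' (suc k)                                <⟨ a-2<T ⟩
    T'                                            ∎
    where open ≤-Reasoning

  -- Signs and the grading by 𝒪_K^0 and 𝒪_K^1

  -*-≡* : ∀ α β → (- α) * (- β) ≡ α * β
  -*-≡* α β = begin
    (- α) * (- β)    ≡⟨ -‿distribˡ-* α (- β) ⟨
    - (α * (- β))    ≡⟨ cong -_ (-‿distribʳ-* α β) ⟨
    - (- (α * β))    ≡⟨ -‿involutive (α * β) ⟩
    α * β            ∎
    where open ≡-Reasoning

  signed : Sign → Zθ → Zθ
  signed Sign.+ α = α
  signed Sign.- α = - α

  signed-* : ∀ s t α β → signed s α * signed t β ≡ signed (s Sign.* t) (α * β)
  signed-* Sign.+ Sign.+ α β = refl
  signed-* Sign.+ Sign.- α β = sym (-‿distribʳ-* α β)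
  signed-* Sign.- Sign.+ α β = sym (-‿distribˡ-* α β)
  signed-* Sign.- Sign.- α β = -*-≡* α β

  signed-involutive : ∀ s α → signed s (signed s α) ≡ α
  signed-involutive Sign.+ α = refl
  signed-involutive Sign.- α = -‿involutive α

  conj-signed : ∀ s α → conj a (signed s α) ≡ signed s (conj a α)
  conj-signed Sign.+ α = refl
  conj-signed Sign.- α = conj-neg α

  HasSign : Sign → Zθ → Set
  HasSign s α = Pos a (signed s α)

  HasSign-* : ∀ s t {α β} → HasSign s α → HasSign t β → HasSign (s Sign.* t) (α * β)
  HasSign-* s t {α} {β} p q = subst (Pos a) (signed-* s t α β) (Pos-* {signed s α} {signed t β} p q)

  HasSign-signed : ∀ s {α} → Pos a α → HasSign s (signed s α)
  HasSign-signed s {α} = subst (Pos a) (sym (signed-involutive s α))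

  HasSign-unique : ∀ s t {α} → HasSign s α → HasSign t α → s ≡ t
  HasSign-unique Sign.+ Sign.+ _ _ = refl
  HasSign-unique Sign.- Sign.- _ _ = refl
  HasSign-unique Sign.+ Sign.- {α} p q = contradiction (subst (Pos a) (-‿inverseʳ α) (Pos-+ {α} { - α} p q)) ¬Pos-0
  HasSign-unique Sign.- Sign.+ {α} p q = contradiction (subst (Pos a) (-‿inverseʳ α) (Pos-+ {α} { - α} q p)) ¬Pos-0

  HasSign⇒≢0 : ∀ s {α} → HasSign s α → α ≢ zero'
  HasSign⇒≢0 Sign.+ p refl = ¬Pos-0 p
  HasSign⇒≢0 Sign.- p refl = ¬Pos-0 p

  HasSign-conj⇒≢0 : ∀ s {δ} → HasSign s (conj a δ) → δ ≢ zero'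
  HasSign-conj⇒≢0 s h refl = HasSign⇒≢0 s h (conj-fromℕ 0)

  signed-injective : ∀ s t {P Q} → Pos a P → Pos a Q → signed s P ≡ signed t Q → P ≡ Q
  signed-injective s t {P} {Q} p q eq
    with HasSign-unique s t (HasSign-signed s p) (subst (HasSign t) (sym eq) (HasSign-signed t q))
  ... | refl = begin
    P                         ≡⟨ signed-involutive s P ⟨
    signed s (signed s P)     ≡⟨ cong (signed s) eq ⟩
    signed s (signed s Q)     ≡⟨ signed-involutive s Q ⟩
    Q                         ∎
    where open ≡-Reasoning

  -- InGrade + and InGrade - are 𝒪_K^0 and 𝒪_K^1: g is the product of the signs of α and α'.
  data InGrade (g : Sign) (α : Zθ) : Set where
    ≡0         : α ≡ zero' → InGrade g α
    with-signs : ∀ s s' → s Sign.* s' ≡ g → HasSign s α → HasSign s' (conj a α) → InGrade g α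

  O0⇒InGrade : ∀ {α} → O0 a α → InGrade Sign.+ α
  O0⇒InGrade (inj₁ (p , p'))        = with-signs Sign.+ Sign.+ refl p p'
  O0⇒InGrade (inj₂ (inj₁ (n , n'))) = with-signs Sign.- Sign.- refl n n'
  O0⇒InGrade (inj₂ (inj₂ α≡0))      = ≡0 α≡0

  O1⇒InGrade : ∀ {α} → O1 a α → InGrade Sign.- α
  O1⇒InGrade (inj₁ (p , n'))        = with-signs Sign.+ Sign.- refl p n'
  O1⇒InGrade (inj₂ (inj₁ (n , p'))) = with-signs Sign.- Sign.+ refl n p'
  O1⇒InGrade (inj₂ (inj₂ α≡0))      = ≡0 α≡0

  InGrade-* : ∀ {g h α β} → InGrade g α → InGrade h β → InGrade (g Sign.* h) (α * β)
  InGrade-* {β = β} (≡0 refl) _ = ≡0 (zeroˡ β)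
  InGrade-* {α = α} (with-signs _ _ _ _ _) (≡0 refl) = ≡0 (zeroʳ α)
  InGrade-* {α = α} {β} (with-signs s s' refl p p') (with-signs t t' refl q q') =
    with-signs (s Sign.* t) (s' Sign.* t') (sign-interchange s t s' t') (HasSign-* s t p q)
      (subst (HasSign (s' Sign.* t')) (sym (conj-* α β)) (HasSign-* s' t' p' q'))

  InGrade-disjoint : ∀ {α} → InGrade Sign.+ α → InGrade Sign.- α → α ≡ zero'
  InGrade-disjoint (≡0 α≡0) _ = α≡0
  InGrade-disjoint (with-signs _ _ _ _ _) (≡0 α≡0) = α≡0
  InGrade-disjoint (with-signs s s' ss'≡+ p p') (with-signs t t' tt'≡- q q')
    with HasSign-unique s t p q | HasSign-unique s' t' p' q'
  ... | refl | refl with trans (sym ss'≡+) tt'≡-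
  ...   | ()

  AbsIs⇒AbsIs0 : ∀ {α v} → InGrade Sign.+ α → AbsIs a α v → AbsIs0 a α v
  AbsIs⇒AbsIs0 _ (inj₁ (_ , h)) = h
  AbsIs⇒AbsIs0 {v = v} α∈O⁰ (inj₂ (o' , h)) with InGrade-disjoint α∈O⁰ (O1⇒InGrade o')
  ... | refl = subst (λ δ → AbsIs0 a δ v) (zeroʳ T') h

  AbsIs⇒AbsIs0-T* : ∀ {α v} → InGrade Sign.- α → AbsIs a α v → AbsIs0 a (T' * α) v
  AbsIs⇒AbsIs0-T* _ (inj₂ (_ , h)) = h
  AbsIs⇒AbsIs0-T* {v = v} α∈O¹ (inj₁ (o , h)) with InGrade-disjoint (O0⇒InGrade o) α∈O¹
  ... | refl = subst (λ δ → AbsIs0 a δ v) (sym (zeroʳ T')) h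

  -- Leading forms and the product bounds

  -- conj α = ± θ^k e with 1 ≤ e < θ and v = θ^k: v = |α|_θ is the largest power of θ below |α'|.
  record LeadingForm (α v : Zθ) : Set where
    field
      sign       : Sign
      exponent   : ℤ
      mantissa   : Zθ
      v≡θ^       : v ≡ θ^ a exponent
      1≤mantissa : one' ≤ mantissa
      mantissa<θ : mantissa < θ'
      conj≡      : conj a α ≡ signed sign (θ^ a exponent * mantissa)

    0<θ^*mantissa : zero' < θ^ a exponent * mantissa
    0<θ^*mantissa = *-pos (0<θ^ exponent) (<-≤-trans 0<1 1≤mantissa)

    conj-HasSign : HasSign sign (conj a α)
    conj-HasSign = subst (HasSign sign) (sym conj≡) (HasSign-signed sign (0<⇒Pos 0<θ^*mantissa))

  open LeadingForm

  ±⇒signed : ∀ {α β} → α ≡ β ⊎ α ≡ - β → Σ Sign λ s → α ≡ signed s β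
  ±⇒signed (inj₁ α≡β)  = Sign.+ , α≡β
  ±⇒signed (inj₂ α≡-β) = Sign.- , α≡-β

  leading-form : ∀ {α v} → AbsIs0 a α v → (α ≡ zero' × v ≡ zero') ⊎ LeadingForm α v
  leading-form (inj₁ α≡0×v≡0) = inj₁ α≡0×v≡0
  leading-form (inj₂ (_ , m , [] , () , _))
  leading-form {α} (inj₂ (_ , m , b ∷ bs , (b≢0 , digits , free) , α≡±θ^E , v≡)) with ±⇒signed α≡±θ^E
  ... | s , α≡ = inj₂ (record
    { sign       = s
    ; exponent   = ℤ.- m
    ; mantissa   = E'
    ; v≡θ^       = v≡
    ; 1≤mantissa = 1≤conj-evalDigits bs b≢0
    ; mantissa<θ = conj-evalDigits<θ (b ∷ bs) digits free
    ; conj≡      = begin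
        conj a α                                    ≡⟨ cong (conj a) α≡ ⟩
        conj a (signed s (θ^ a m * E))              ≡⟨ conj-signed s (θ^ a m * E) ⟩
        signed s (conj a (θ^ a m * E))              ≡⟨ cong (signed s) (conj-* (θ^ a m) E) ⟩
        signed s (conj a (θ^ a m) * E')             ≡⟨ cong (λ β → signed s (β * E')) (conj-θ^ m) ⟩
        signed s (θ^ a (ℤ.- m) * E')                ∎
    })
    where
    open ≡-Reasoning
    E E' : Zθ
    E  = evalDigits a (b ∷ bs)
    E' = conj a E

  product≢0 : ∀ {α β u v} → LeadingForm α u → LeadingForm β v → α * β ≢ zero'
  product≢0 {α} {β} Lα Lβ = HasSign-conj⇒≢0 (sign Lα Sign.* sign Lβ)
    (subst (HasSign (sign Lα Sign.* sign Lβ)) (sym (conj-* α β))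
      (HasSign-* (sign Lα) (sign Lβ) {conj a α} {conj a β} (conj-HasSign Lα) (conj-HasSign Lβ)))

  scaled≢0 : ∀ {c γ w} → zero' < conj a c → LeadingForm γ w → c * γ ≢ zero'
  scaled≢0 {c} {γ} 0<c' Lγ = HasSign-conj⇒≢0 (sign Lγ)
    (subst (HasSign (sign Lγ)) (sym (conj-* c γ))
      (HasSign-* Sign.+ (sign Lγ) {conj a c} {conj a γ} (0<⇒Pos 0<c') (conj-HasSign Lγ)))

  mantissa-product : ∀ {e₁ e₂} → one' ≤ e₁ → e₁ < θ' → one' ≤ e₂ → e₂ < θ' → one' ≤ e₁ * e₂ × e₁ * e₂ < θ^ a (+ 2)
  mantissa-product {e₁} {e₂} 1≤e₁ e₁<θ 1≤e₂ e₂<θ =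
    (begin
      one'        ≤⟨ 1≤e₁ ⟩
      e₁          ≡⟨ *-identityʳ e₁ ⟨
      e₁ * one'   ≤⟨ *-monoˡ-≤ 0<e₁ 1≤e₂ ⟩
      e₁ * e₂     ∎) ,
    (begin-strict
      e₁ * e₂               <⟨ *-monoˡ-< 0<e₁ e₂<θ ⟩
      e₁ * θ'               <⟨ *-monoʳ-< (0<θ) e₁<θ ⟩
      θ' * θ'               ≡⟨ cong (θ' *_) (*-identityʳ θ') ⟨
      θ^ a (+ 2)            ∎)
    where
    open ≤-Reasoning
    0<e₁ : zero' < e₁
    0<e₁ = <-≤-trans 0<1 1≤e₁

  exponent-bounds : ∀ {s k E e c} j → θ^ a (ℤ.- + j) ≤ c → c ≤ one' →
                    one' ≤ E → E < θ^ a (+ 2) → one' ≤ e → e < θ' →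
                    θ^ a s * E ≡ c * (θ^ a k * e) → s ℤ.≤ k × k ℤ.≤ + suc j ℤ.+ s
  exponent-bounds {s} {k} {E} {e} {c} j θ^-j≤c c≤1 1≤E E<θ² 1≤e e<θ eq = lower , upper
    where
    open ≤-Reasoning
    0<e : zero' < e
    0<e = <-≤-trans 0<1 1≤e
    0<c : zero' < c
    0<c = <-≤-trans (0<θ^ (ℤ.- + j)) θ^-j≤c
    lower : s ℤ.≤ k
    lower = subst (s ℤ.≤_) (ℤ.pred-suc k) (ℤ.i<j⇒i≤pred[j] (θ^-cancel-< {s} {ℤ.1ℤ ℤ.+ k} (begin-strict
      θ^ a s              ≡⟨ *-identityʳ (θ^ a s) ⟨
      θ^ a s * one'       ≤⟨ *-monoˡ-≤ (0<θ^ s) 1≤E ⟩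
      θ^ a s * E          ≡⟨ eq ⟩
      c * (θ^ a k * e)    ≤⟨ *-monoʳ-≤ (*-pos (0<θ^ k) 0<e) c≤1 ⟩
      one' * (θ^ a k * e) ≡⟨ *-identityˡ (θ^ a k * e) ⟩
      θ^ a k * e          <⟨ *-monoˡ-< (0<θ^ k) e<θ ⟩
      θ^ a k * θ'         ≡⟨ *-comm (θ^ a k) θ' ⟩
      θ' * θ^ a k         ≡⟨ θ^-suc k ⟨
      θ^ a (ℤ.1ℤ ℤ.+ k)   ∎)))
    upper : k ℤ.≤ + suc j ℤ.+ s
    upper = subst₂ ℤ._≤_ (cancel (+ j) k) (shift (+ j) s)
      (ℤ.+-monoʳ-≤ (+ j) (ℤ.i<j⇒i≤pred[j] (θ^-cancel-< {ℤ.- + j ℤ.+ k} {s ℤ.+ + 2} (begin-strict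
      θ^ a (ℤ.- + j ℤ.+ k)          ≡⟨ θ^-+ (ℤ.- + j) k ⟩
      θ^ a (ℤ.- + j) * θ^ a k       ≤⟨ *-monoʳ-≤ (0<θ^ k) θ^-j≤c ⟩
      c * θ^ a k                    ≡⟨ *-identityʳ (c * θ^ a k) ⟨
      c * θ^ a k * one'             ≤⟨ *-monoˡ-≤ (*-pos 0<c (0<θ^ k)) 1≤e ⟩
      c * θ^ a k * e                ≡⟨ *-assoc c (θ^ a k) e ⟩
      c * (θ^ a k * e)              ≡⟨ eq ⟨
      θ^ a s * E                    <⟨ *-monoˡ-< (0<θ^ s) E<θ² ⟩
      θ^ a s * θ^ a (+ 2)           ≡⟨ θ^-+ s (+ 2) ⟨
      θ^ a (s ℤ.+ + 2)              ∎))))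
      where
      cancel : ∀ J k → J ℤ.+ (ℤ.- J ℤ.+ k) ≡ k
      cancel = solve-∀
      shift : ∀ J s → J ℤ.+ (ℤ.-1ℤ ℤ.+ (s ℤ.+ + 2)) ≡ ℤ.1ℤ ℤ.+ J ℤ.+ s
      shift = solve-∀

  ≤⇒≤[a] : ∀ {α β} → α ≤ β → α ≤[ a ] β
  ≤⇒≤[a] {α} (inj₁ refl)       = inj₁ (-‿inverseʳ α)
  ≤⇒≤[a]     (inj₂ (by-Pos p)) = inj₂ p

  leading-product-bounds : ∀ {α β γ c u v w C} j → θ^ a (ℤ.- + j) ≤ conj a c → conj a c ≤ one' →
                           C ≡ θ^ a (+ suc j) → LeadingForm α u → LeadingForm β v → LeadingForm γ w → α * β ≡ c * γ →
                           (u * v) ≤[ a ] w × w ≤[ a ] (C * (u * v))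
  leading-product-bounds {α} {β} {γ} {c} {u} {v} {w} {C} j θ^-j≤c' c'≤1 C≡ Lα Lβ Lγ αβ≡cγ =
    ≤⇒≤[a] (subst₂ _≤_ (sym uv≡θ^s) (sym (v≡θ^ Lγ)) (θ^-mono-≤ {s} {k₃} s≤k₃)) ,
    ≤⇒≤[a] (subst₂ _≤_ (sym (v≡θ^ Lγ)) (sym Cuv≡θ^[1+j+s]) (θ^-mono-≤ {k₃} {+ suc j ℤ.+ s} k₃≤1+j+s))
    where
    open ≡-Reasoning
    k₁ k₂ k₃ s : ℤ
    k₁ = exponent Lα
    k₂ = exponent Lβ
    k₃ = exponent Lγ
    s  = k₁ ℤ.+ k₂
    e₁ e₂ e₃ : Zθ
    e₁ = mantissa Lα
    e₂ = mantissa Lβ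
    e₃ = mantissa Lγ
    uv≡θ^s : u * v ≡ θ^ a s
    uv≡θ^s = trans (cong₂ _*_ (v≡θ^ Lα) (v≡θ^ Lβ)) (sym (θ^-+ k₁ k₂))
    Cuv≡θ^[1+j+s] : C * (u * v) ≡ θ^ a (+ suc j ℤ.+ s)
    Cuv≡θ^[1+j+s] = trans (cong₂ _*_ C≡ uv≡θ^s) (sym (θ^-+ (+ suc j) s))
    conj-αβ : conj a (α * β) ≡ signed (sign Lα Sign.* sign Lβ) (θ^ a s * (e₁ * e₂))
    conj-αβ = begin
      conj a (α * β)                                                          ≡⟨ conj-* α β ⟩
      conj a α * conj a β                                                     ≡⟨ cong₂ _*_ (conj≡ Lα) (conj≡ Lβ) ⟩
      signed (sign Lα) (θ^ a k₁ * e₁) * signed (sign Lβ) (θ^ a k₂ * e₂)       ≡⟨ signed-* (sign Lα) (sign Lβ) _ _ ⟩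
      signed (sign Lα Sign.* sign Lβ) ((θ^ a k₁ * e₁) * (θ^ a k₂ * e₂))
        ≡⟨ cong (signed _) (*-interchange (θ^ a k₁) e₁ (θ^ a k₂) e₂) ⟩
      signed (sign Lα Sign.* sign Lβ) ((θ^ a k₁ * θ^ a k₂) * (e₁ * e₂))
        ≡⟨ cong (λ δ → signed _ (δ * (e₁ * e₂))) (θ^-+ k₁ k₂) ⟨
      signed (sign Lα Sign.* sign Lβ) (θ^ a s * (e₁ * e₂))                    ∎
    conj-cγ : conj a (c * γ) ≡ signed (sign Lγ) (conj a c * (θ^ a k₃ * e₃))
    conj-cγ = trans (conj-* c γ) (trans (cong (conj a c *_) (conj≡ Lγ)) (signed-* Sign.+ (sign Lγ) (conj a c) _))
    1≤E×E<θ² = mantissa-product (1≤mantissa Lα) (mantissa<θ Lα) (1≤mantissa Lβ) (mantissa<θ Lβ)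
    θ^sE≡cθ^k₃e₃ : θ^ a s * (e₁ * e₂) ≡ conj a c * (θ^ a k₃ * e₃)
    θ^sE≡cθ^k₃e₃ = signed-injective (sign Lα Sign.* sign Lβ) (sign Lγ)
      (0<⇒Pos (*-pos (0<θ^ s) (<-≤-trans 0<1 (proj₁ 1≤E×E<θ²))))
      (0<⇒Pos (*-pos (<-≤-trans (0<θ^ (ℤ.- + j)) θ^-j≤c') (0<θ^*mantissa Lγ)))
      (trans (sym conj-αβ) (trans (cong (conj a) αβ≡cγ) conj-cγ))
    bounds = exponent-bounds {s} {k₃} j θ^-j≤c' c'≤1 (proj₁ 1≤E×E<θ²) (proj₂ 1≤E×E<θ²)
                             (1≤mantissa Lγ) (mantissa<θ Lγ) θ^sE≡cθ^k₃e₃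
    s≤k₃ = proj₁ bounds
    k₃≤1+j+s = proj₂ bounds

  zero-bounds : ∀ {uv w C} → uv ≡ zero' → w ≡ zero' → uv ≤[ a ] w × w ≤[ a ] (C * uv)
  zero-bounds {C = C} refl refl = ≤⇒≤[a] {zero'} (inj₁ refl) , ≤⇒≤[a] {zero'} (inj₁ (sym (zeroʳ C)))

  product-bounds : ∀ {α β γ c u v w C} j → θ^ a (ℤ.- + j) ≤ conj a c → conj a c ≤ one' →
                   C ≡ θ^ a (+ suc j) → AbsIs0 a α u → AbsIs0 a β v → AbsIs0 a γ w → α * β ≡ c * γ →
                   (u * v) ≤[ a ] w × w ≤[ a ] (C * (u * v))
  product-bounds {α} {β} {γ} {c} {u} {v} {w} {C} j θ^-j≤c' c'≤1 C≡ hα hβ hγ αβ≡cγ =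
    by-cases (leading-form hα) (leading-form hβ) (leading-form hγ)
    where
    0<c' : zero' < conj a c
    0<c' = <-≤-trans (0<θ^ (ℤ.- + j)) θ^-j≤c'
    by-cases : (α ≡ zero' × u ≡ zero') ⊎ LeadingForm α u → (β ≡ zero' × v ≡ zero') ⊎ LeadingForm β v →
               (γ ≡ zero' × w ≡ zero') ⊎ LeadingForm γ w → (u * v) ≤[ a ] w × w ≤[ a ] (C * (u * v))
    by-cases (inj₁ (_ , u≡0)) _ (inj₁ (_ , w≡0)) =
      zero-bounds {C = C} (trans (cong (_* v) u≡0) (zeroˡ v)) w≡0
    by-cases (inj₂ _) (inj₁ (_ , v≡0)) (inj₁ (_ , w≡0)) =
      zero-bounds {C = C} (trans (cong (u *_) v≡0) (zeroʳ u)) w≡0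
    by-cases (inj₁ (α≡0 , _)) _ (inj₂ Lγ) =
      contradiction (trans (sym αβ≡cγ) (trans (cong (_* β) α≡0) (zeroˡ β))) (scaled≢0 {c} {γ} 0<c' Lγ)
    by-cases (inj₂ _) (inj₁ (β≡0 , _)) (inj₂ Lγ) =
      contradiction (trans (sym αβ≡cγ) (trans (cong (α *_) β≡0) (zeroʳ α))) (scaled≢0 {c} {γ} 0<c' Lγ)
    by-cases (inj₂ Lα) (inj₂ Lβ) (inj₁ (γ≡0 , _)) =
      contradiction (trans αβ≡cγ (trans (cong (c *_) γ≡0) (zeroʳ c))) (product≢0 {α} {β} Lα Lβ)
    by-cases (inj₂ Lα) (inj₂ Lβ) (inj₂ Lγ) =
      leading-product-bounds {α} {β} {γ} {c} j θ^-j≤c' c'≤1 C≡ Lα Lβ Lγ αβ≡cγ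

  θ^-1≤[a-2]θinv : θ^ a (ℤ.- + 1) ≤ fromℕ' (suc k) * θinv a
  θ^-1≤[a-2]θinv = begin
    θinv a * one'              ≡⟨ *-comm (θinv a) one' ⟩
    one' * θinv a              ≤⟨ *-monoʳ-≤ (0<θinv) (fromℕ-≤ {1} {suc k} (ℕ.s≤s ℕ.z≤n)) ⟩
    fromℕ' (suc k) * θinv a    ∎
    where open ≤-Reasoning

  [a-2]θinv≤1 : fromℕ' (suc k) * θinv a ≤ one'
  [a-2]θinv≤1 = begin
    fromℕ' (suc k) * θinv a    <⟨ *-monoʳ-< (0<θinv) (<-trans (fromℕ-< ℕ.≤-refl) a-1<θ) ⟩
    θ' * θinv a                ≡⟨ θ*θinv ⟩
    one'                       ∎
    where open ≤-Reasoning

  bounds-O0-O0 : ∀ f g → O0 a f → O0 a g → (u v w : Zθ) → AbsIs a f u → AbsIs a g v → AbsIs a (f * g) w →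
                 ((u * v) ≤[ a ] w) × (w ≤[ a ] (θ' * (u * v)))
  bounds-O0-O0 f g f∈O⁰ g∈O⁰ u v w hu hv hw =
    product-bounds {c = one'} 0 (inj₁ (sym (conj-fromℕ 1))) (inj₁ (conj-fromℕ 1)) (sym (*-identityʳ θ'))
      (AbsIs⇒AbsIs0 (O0⇒InGrade f∈O⁰) hu) (AbsIs⇒AbsIs0 (O0⇒InGrade g∈O⁰) hv)
      (AbsIs⇒AbsIs0 (InGrade-* (O0⇒InGrade f∈O⁰) (O0⇒InGrade g∈O⁰)) hw)
      (sym (*-identityˡ (f * g)))

  bounds-O1-O1 : ∀ f g → O1 a f → O1 a g → (u v w : Zθ) → AbsIs a f u → AbsIs a g v → AbsIs a (f * g) w →
                 ((u * v) ≤[ a ] w) × (w ≤[ a ] ((θ' * θ') * (u * v)))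
  bounds-O1-O1 f g f∈O¹ g∈O¹ u v w hu hv hw =
    product-bounds {c = fromℕ' (suc k) * θ'} 1
      (subst (θ^ a (ℤ.- + 1) ≤_) (sym conj-[a-2]θ) θ^-1≤[a-2]θinv)
      (subst (_≤ one') (sym conj-[a-2]θ) [a-2]θinv≤1)
      (cong (θ' *_) (sym (*-identityʳ θ')))
      (AbsIs⇒AbsIs0-T* (O1⇒InGrade f∈O¹) hu) (AbsIs⇒AbsIs0-T* (O1⇒InGrade g∈O¹) hv)
      (AbsIs⇒AbsIs0 (InGrade-* (O1⇒InGrade f∈O¹) (O1⇒InGrade g∈O¹)) hw)
      (trans (*-interchange T' f T' g) (cong (_* (f * g)) T*T≡[a-2]θ))
    where
    conj-[a-2]θ : conj a (fromℕ' (suc k) * θ') ≡ fromℕ' (suc k) * θinv a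
    conj-[a-2]θ = trans (conj-* (fromℕ' (suc k)) θ') (cong₂ _*_ (conj-fromℕ (suc k)) conj-θ)

  bounds-O0-O1 : ∀ f g → O0 a f → O1 a g → (u v w : Zθ) → AbsIs a f u → AbsIs a g v → AbsIs a (f * g) w →
                 ((u * v) ≤[ a ] w) × (w ≤[ a ] (θ' * (u * v)))
  bounds-O0-O1 f g f∈O⁰ g∈O¹ u v w hu hv hw =
    product-bounds {c = one'} 0 (inj₁ (sym (conj-fromℕ 1))) (inj₁ (conj-fromℕ 1)) (sym (*-identityʳ θ'))
      (AbsIs⇒AbsIs0 (O0⇒InGrade f∈O⁰) hu) (AbsIs⇒AbsIs0-T* (O1⇒InGrade g∈O¹) hv)
      (AbsIs⇒AbsIs0-T* (InGrade-* (O0⇒InGrade f∈O⁰) (O1⇒InGrade g∈O¹)) hw)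
      (trans (x∙yz≈y∙xz f T' g) (sym (*-identityˡ (T' * (f * g)))))

open import Data.Nat using (_≤_)

theorem7 : (a : ℕ) → 3 ≤ a → (f g : Zθ) →
    ((O0 a f → O0 a g → (u v w : Zθ) → AbsIs a f u → AbsIs a g v → AbsIs a (mul a f g) w →
        (mul a u v ≤[ a ] w) × (w ≤[ a ] mul a θ' (mul a u v))))
    × ((O1 a f → O1 a g → (u v w : Zθ) → AbsIs a f u → AbsIs a g v → AbsIs a (mul a f g) w →
        (mul a u v ≤[ a ] w) × (w ≤[ a ] mul a (mul a θ' θ') (mul a u v))))
    × ((O0 a f → O1 a g → (u v w : Zθ) → AbsIs a f u → AbsIs a g v → AbsIs a (mul a f g) w →
        (mul a u v ≤[ a ] w) × (w ≤[ a ] mul a θ' (mul a u v))))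
theorem7 (suc (suc (suc k))) (ℕ.s≤s (ℕ.s≤s (ℕ.s≤s ℕ.z≤n))) f g =
  QuadraticUnit.bounds-O0-O0 k f g , QuadraticUnit.bounds-O1-O1 k f g , QuadraticUnit.bounds-O0-O1 k f g
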